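{- Let $\mathcal{A}$ be a finite non-empty separating union-closed family of sets whose universe $U(\mathcal{A})=\bigcup_{A\in\mathcal{A}}A$ has $m\geq 2$ elements. If $$|\mathcal{A}|\leq 2\left(m+\frac{m}{\log_2(m)-\log_2\log_2(m)}\right),$$ then there exists an element $x\in U(\mathcal{A})$ with $|\{A\in\mathcal{A}:\, x\in A\}|\geq \frac{1}{2}|\mathcal{A}|$.
   Context: A family $\mathcal{A}$ of sets is union-closed if $A\cup B\in\mathcal{A}$ for all $A,B\in\mathcal{A}$. It is separating if for any two distinct elements $x,y\in U(\mathcal{A})$ there is a set $A\in\mathcal{A}$ containing exactly one of $x$ and $y$. The frequency of $x$ is $|\{A\in\mathcal{A}:\, x\in A\}|$. -}

module Defs where

open import Data.Nat using (ℕ; suc; _+_; _*_; _∸_; _^_; _≤_; _<_)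
open import Data.Product using (Σ; _×_; ∃-syntax)
open import Data.Sum using (_⊎_)
open import Data.List using (List; length; filter)
open import Data.List.Relation.Unary.Unique.Propositional using (Unique)
import Data.List.Membership.Propositional as L
open import Data.Fin using (Fin)
open import Data.Fin.Subset using (Subset; _∈_; _∉_; _∪_; ⋃; ∣_∣)
open import Data.Fin.Subset.Properties using (_∈?_)
open import Relation.Binary.PropositionalEquality using (_≢_)

-- A finite family of finite sets: all sets are subsets of a ground set Fin k
-- (any finite family of finite sets lives inside a finite ground set).
-- The family is a list of subsets with no repetitions (so it is a set of sets).
record Family (k : ℕ) : Set where
  constructor mkFamily
  field
    sets     : List (Subset k)
    distinct : Unique sets
open Family public

size : ∀ {k} → Family k → ℕ
size 𝒜 = length (sets 𝒜)

universe : ∀ {k} → Family k → Subset k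
universe 𝒜 = ⋃ (sets 𝒜)

NonEmptyFamily : ∀ {k} → Family k → Set
NonEmptyFamily 𝒜 = 1 ≤ size 𝒜

UnionClosed : ∀ {k} → Family k → Set
UnionClosed 𝒜 = ∀ {A B} → A L.∈ sets 𝒜 → B L.∈ sets 𝒜 → (A ∪ B) L.∈ sets 𝒜

Separating : ∀ {k} → Family k → Set
Separating 𝒜 = ∀ {x y} → x ∈ universe 𝒜 → y ∈ universe 𝒜 → x ≢ y →
  ∃[ A ] (A L.∈ sets 𝒜 × ((x ∈ A × y ∉ A) ⊎ (y ∈ A × x ∉ A)))

frequency : ∀ {k} → Family k → Fin k → ℕ
frequency 𝒜 x = length (filter (x ∈?_) (sets 𝒜))

-- SizeBound n m  ⟺  n ≤ 2 (m + m / (log₂ m − log₂ log₂ m))   (for m ≥ 2),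
-- stated exactly with integer arithmetic:
-- either n ≤ 2m, or, with d = n − 2m ≥ 1 and c = m · 2^(−2m/d),
-- c ≤ log₂ m, expressed via rationals p/s (s ≥ 1):
--   p/s < c  (⟺ p^d · 2^(2m) < m^d · s^d)   implies   p/s ≤ log₂ m (⟺ 2^p ≤ m^s).
SizeBound : ℕ → ℕ → Set
SizeBound n m =
  n ≤ 2 * m ⊎
  (∀ (p s : ℕ) → 1 ≤ s →
     p ^ (n ∸ 2 * m) * 2 ^ (2 * m) < m ^ (n ∸ 2 * m) * s ^ (n ∸ 2 * m) →
     2 ^ p ≤ m ^ s)

module Submission where

-- Suppose every element of U lies in fewer than half of the n members. Call t ∈ U minimal if every
-- other element of U is separated from t by a member containing t; climbing along "every member
-- containing x contains y" raises the frequency, so every nonempty member contains a minimal element.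
-- Shrink the minimal elements to an irredundant transversal T of the nonempty members, k = ∣T∣.
-- Irredundancy gives each t ∈ T a member meeting T in {t}, and unions of these realise every
-- nonempty R ⊆ T as a trace A ∩ T; besides, U and the largest members avoiding the w = m − k
-- elements of U − T are w + 1 distinct members containing T. Counting Σ_A ∣A ∩ T∣ = Σ_{t∈T} freq t
-- < kn/2 against these traces gives (k − 2)(n + 1) ≥ 2(k − 1)(w + 1) + (k − 2)2^k, which is absurd
-- for k ≤ 2 and for k ≥ 3 pushes n − 2m beyond 2m/(log₂ m − log₂ log₂ m). That last comparison is
-- made in integers: for m ≥ 256 through b = ⌊log₂ m⌋ and the a with m^(2^a) < 2^m ≤ m^(2^(a+1)),
-- for smaller m through a table of rational certificates, and for k = 3, m ≤ 5 by also counting the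
-- members that meet T in a single element.

open import Data.Bool using (Bool; true; false)
import Data.Bool as Bool
open import Data.Empty using (⊥; ⊥-elim)
open import Data.Fin using (Fin; zero; suc; toℕ; fromℕ<)
import Data.Fin as Fin
open import Data.Fin.Properties using (all?; any?; ¬∀⟶∃¬; toℕ-fromℕ<)
open import Data.Fin.Subset using (Subset; inside; outside; _∈_; _∉_; _⊆_; _∪_; _∩_; _─_; _-_; ⁅_⁆; ⋃; ∣_∣; Nonempty)
  renaming (⊥ to ∅)
open import Data.Fin.Subset.Properties using (_∈?_; _⊆?_; nonempty?; ∉⊥; ∣⊥∣≡0; ∣⁅x⁆∣≡1; p⊆q⇒∣p∣≤∣q∣; Empty-unique;
  drop-there; drop-∷-⊆; in⊆in; out⊆; ⊆-antisym; p⊆p∪q; q⊆p∪q; x∈p∪q⁻; x∈p∪q⁺; ∪-identityʳ; p∩q⊆q; x∈p∩q⁺; x∈p∩q⁻;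
  x∈⁅x⁆; x∈⁅y⁆⇒x≡y; x≢y⇒x∉⁅y⁆; p─q⊆p; x∈p∧x∉q⇒x∈p─q; x∈p∧x≢y⇒x∈p-y)
open import Data.List using (List; []; _∷_; _++_; map; length; filter; allFin; concatMap)
open import Data.List.Membership.Propositional using (find; lose) renaming (_∈_ to _∈ₗ_)
open import Data.List.Membership.Propositional.Properties using (∈-map⁺; ∈-map⁻; ∈-++⁺ˡ; ∈-++⁺ʳ; ∈-++⁻; ∈-allFin;
  ∈-filter⁺; ∈-filter⁻; ∈-concatMap⁺)
open import Data.List.Properties using (length-++; length-map; length-filter; map-tabulate)
open import Data.List.Relation.Binary.Disjoint.Propositional using (Disjoint)
open import Data.List.Relation.Unary.All as All using (All; [])
open import Data.List.Relation.Unary.All.Properties using (¬All⇒Any¬) renaming (map⁺ to All-map⁺)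
open import Data.List.Relation.Unary.AllPairs using ([]; _∷_)
open import Data.List.Relation.Unary.Any as Any using (Any; here; there) renaming (_─_ to _─ₗ_)
open import Data.List.Relation.Unary.Unique.Propositional using (Unique)
import Data.List.Relation.Unary.Unique.Propositional.Properties as Unique
open import Data.Nat using (ℕ; zero; suc; _+_; _*_; _∸_; _^_; _≤_; _<_; z≤n; s≤s; NonZero; >-nonZero; _≟_; _≤?_; _<?_)
open import Data.Nat.Induction using (<-wellFounded)
open import Data.Nat.Properties
open import Algebra.Properties.CommutativeSemigroup +-commutativeSemigroup using ()
  renaming (interchange to +-interchange; x∙yz≈y∙xz to +-exchange)
open import Data.Nat.Tactic.RingSolver using (solve-∀)
open import Data.Product using (∃-syntax; _×_; _,_; proj₁; proj₂; uncurry)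
open import Data.Sum using (_⊎_; inj₁; inj₂)
open import Data.Unit using (tt)
open import Data.Vec using (Vec; []; _∷_; lookup)
import Data.Vec as Vec
open import Data.Vec.Properties using (≡-dec; ∷-injectiveʳ; lookup∘tabulate; []=⇒lookup; lookup⇒[]=)
open import Function using (id; _∘_)
open import Induction.WellFounded using (Acc; acc)
import Relation.Binary.Construct.On as On
open import Relation.Binary.Definitions using (DecidableEquality)
open import Relation.Binary.PropositionalEquality using (_≡_; _≢_; refl; sym; trans; cong; cong₂; subst; subst₂;
  module ≡-Reasoning)
open import Relation.Nullary using (¬_; ¬?; Dec; does; yes; no; _×-dec_; _→-dec_)
open import Relation.Nullary.Decidable using (toWitness; dec-true; dec-false)
open import Relation.Unary using (Decidable)

open import Defs

-- Finite sums

𝟙 : Bool → ℕ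
𝟙 true  = 1
𝟙 false = 0

∑ : ∀ {a} {A : Set a} → (A → ℕ) → List A → ℕ
∑ f []       = 0
∑ f (x ∷ xs) = f x + ∑ f xs

module _ {a} {A : Set a} where

  ∑-++ : ∀ (f : A → ℕ) xs ys → ∑ f (xs ++ ys) ≡ ∑ f xs + ∑ f ys
  ∑-++ f []       ys = refl
  ∑-++ f (x ∷ xs) ys = trans (cong (f x +_) (∑-++ f xs ys)) (sym (+-assoc (f x) _ _))

  ∑-map : ∀ {b} {B : Set b} (f : B → ℕ) (g : A → B) xs → ∑ f (map g xs) ≡ ∑ (λ x → f (g x)) xs
  ∑-map f g []       = refl
  ∑-map f g (x ∷ xs) = cong (f (g x) +_) (∑-map f g xs)

  ∑-+ : ∀ (f g : A → ℕ) xs → ∑ (λ x → f x + g x) xs ≡ ∑ f xs + ∑ g xs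
  ∑-+ f g []       = refl
  ∑-+ f g (x ∷ xs) = trans (cong (f x + g x +_) (∑-+ f g xs)) (+-interchange (f x) (g x) _ _)

  ∑-*ˡ : ∀ c (f : A → ℕ) xs → ∑ (λ x → c * f x) xs ≡ c * ∑ f xs
  ∑-*ˡ c f []       = sym (*-zeroʳ c)
  ∑-*ˡ c f (x ∷ xs) = trans (cong (c * f x +_) (∑-*ˡ c f xs)) (sym (*-distribˡ-+ c (f x) _))

  ∑-const : ∀ c (xs : List A) → ∑ (λ _ → c) xs ≡ c * length xs
  ∑-const c []       = sym (*-zeroʳ c)
  ∑-const c (x ∷ xs) = trans (cong (c +_) (∑-const c xs)) (sym (*-suc c (length xs)))

  ∑-cong : ∀ {f g : A → ℕ} xs → (∀ {x} → x ∈ₗ xs → f x ≡ g x) → ∑ f xs ≡ ∑ g xs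
  ∑-cong []       eq = refl
  ∑-cong (x ∷ xs) eq = cong₂ _+_ (eq (here refl)) (∑-cong xs (λ p → eq (there p)))

  ∑-mono : ∀ {f g : A → ℕ} xs → (∀ {x} → x ∈ₗ xs → f x ≤ g x) → ∑ f xs ≤ ∑ g xs
  ∑-mono []       le = z≤n
  ∑-mono (x ∷ xs) le = +-mono-≤ (le (here refl)) (∑-mono xs (λ p → le (there p)))

  ∑-mono-< : ∀ {f g : A → ℕ} xs → (∀ {x} → x ∈ₗ xs → f x ≤ g x) →
             ∀ {y} → y ∈ₗ xs → f y < g y → ∑ f xs < ∑ g xs
  ∑-mono-< (x ∷ xs) le (here refl) lt = +-mono-<-≤ lt (∑-mono xs (λ p → le (there p)))
  ∑-mono-< (x ∷ xs) le (there p)   lt = +-mono-≤-< (le (here refl)) (∑-mono-< xs (λ q → le (there q)) p lt)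

  ∑-─ : ∀ (f : A → ℕ) {x xs} (p : x ∈ₗ xs) → ∑ f xs ≡ f x + ∑ f (xs ─ₗ p)
  ∑-─ f (here refl)            = refl
  ∑-─ f {x} {y ∷ xs} (there p) = trans (cong (f y +_) (∑-─ f p)) (+-exchange (f y) (f x) (∑ f (xs ─ₗ p)))

  ∈-─⁺ : ∀ {x y : A} {xs} (p : x ∈ₗ xs) → y ∈ₗ xs → y ≢ x → y ∈ₗ (xs ─ₗ p)
  ∈-─⁺ (here refl) (here refl) y≢x = ⊥-elim (y≢x refl)
  ∈-─⁺ (here refl) (there q)   y≢x = q
  ∈-─⁺ (there p)   (here refl) y≢x = here refl
  ∈-─⁺ (there p)   (there q)   y≢x = there (∈-─⁺ p q y≢x)

  ∑-sublist : ∀ (f : A → ℕ) {ys} xs → Unique ys → (∀ {y} → y ∈ₗ ys → y ∈ₗ xs) → ∑ f ys ≤ ∑ f xs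
  ∑-sublist f {[]}     xs _            _   = z≤n
  ∑-sublist f {y ∷ ys} xs (y∉ys ∷ uys) sub = begin
    f y + ∑ f ys        ≤⟨ +-monoʳ-≤ (f y) (∑-sublist f (xs ─ₗ y∈xs) uys sub′) ⟩
    f y + ∑ f (xs ─ₗ y∈xs) ≡⟨ sym (∑-─ f y∈xs) ⟩
    ∑ f xs              ∎
    where
    open ≤-Reasoning
    y∈xs : y ∈ₗ xs
    y∈xs = sub (here refl)
    sub′ : ∀ {z} → z ∈ₗ ys → z ∈ₗ (xs ─ₗ y∈xs)
    sub′ z∈ys = ∈-─⁺ y∈xs (sub (there z∈ys)) (λ z≡y → All.lookup y∉ys z∈ys (sym z≡y))

  ∑1≡length : ∀ (xs : List A) → ∑ (λ _ → 1) xs ≡ length xs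
  ∑1≡length xs = trans (∑-const 1 xs) (*-identityˡ _)

  length-sublist : ∀ {ys} xs → Unique ys → (∀ {y} → y ∈ₗ ys → y ∈ₗ xs) → length ys ≤ length xs
  length-sublist {ys} xs uys sub = subst₂ _≤_ (∑1≡length ys) (∑1≡length xs) (∑-sublist (λ _ → 1) xs uys sub)

  Unique-map⁺ : ∀ {b} {B : Set b} (f : A → B) {xs} → (∀ {x y} → x ∈ₗ xs → y ∈ₗ xs → f x ≡ f y → x ≡ y) →
                Unique xs → Unique (map f xs)
  Unique-map⁺ f {[]}     _   []           = []
  Unique-map⁺ f {x ∷ xs} inj (x∉xs ∷ uxs) =
    All-map⁺ (All.tabulate (λ y∈xs fx≡fy → All.lookup x∉xs y∈xs (inj (here refl) (there y∈xs) fx≡fy)))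
    ∷ Unique-map⁺ f (λ p q → inj (there p) (there q)) uxs

  ≤-∑ : ∀ (f : A → ℕ) {x xs} → x ∈ₗ xs → f x ≤ ∑ f xs
  ≤-∑ f (here refl) = m≤m+n _ _
  ≤-∑ f {xs = y ∷ ys} (there p) = ≤-trans (≤-∑ f p) (m≤n+m (∑ f ys) (f y))

  module _ {p} {P : A → Set p} (P? : Decidable P) where

    length-filter≡∑ : ∀ xs → length (filter P? xs) ≡ ∑ (λ x → 𝟙 (does (P? x))) xs
    length-filter≡∑ []       = refl
    length-filter≡∑ (x ∷ xs) with does (P? x)
    ... | true  = cong suc (length-filter≡∑ xs)
    ... | false = length-filter≡∑ xs

    ∑-filter-partition : ∀ (f : A → ℕ) xs → ∑ f xs ≡ ∑ f (filter P? xs) + ∑ f (filter (¬? ∘ P?) xs)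
    ∑-filter-partition f [] = refl
    ∑-filter-partition f (x ∷ xs) with P? x
    ... | yes _ = trans (cong (f x +_) (∑-filter-partition f xs)) (sym (+-assoc (f x) (∑ f (filter P? xs)) _))
    ... | no  _ = trans (cong (f x +_) (∑-filter-partition f xs)) (+-exchange (f x) (∑ f (filter P? xs)) _)

    ∃-∉-filter : ∀ xs → length (filter P? xs) < length xs → ∃[ x ] (x ∈ₗ xs × ¬ P x)
    ∃-∉-filter (x ∷ xs) lt with P? x
    ... | no ¬Px = x , here refl , ¬Px
    ... | yes _  = let (y , y∈xs , ¬Py) = ∃-∉-filter xs (≤-pred lt) in y , there y∈xs , ¬Py

∑-swap : ∀ {a b} {A : Set a} {B : Set b} (f : A → B → ℕ) xs ys →
         ∑ (λ x → ∑ (f x) ys) xs ≡ ∑ (λ y → ∑ (λ x → f x y) xs) ys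
∑-swap f []       ys = sym (trans (∑-const 0 ys) (*-zeroˡ (length ys)))
∑-swap f (x ∷ xs) ys = trans (cong (∑ (f x) ys +_) (∑-swap f xs ys)) (sym (∑-+ (f x) _ ys))

∑-allFin-suc : ∀ {k} (g : Fin (suc k) → ℕ) → ∑ g (allFin (suc k)) ≡ g zero + ∑ (λ i → g (suc i)) (allFin k)
∑-allFin-suc {k} g = cong (g zero +_) (trans (cong (∑ g) (sym (map-tabulate id suc))) (∑-map g suc (allFin k)))

length-concatMap : ∀ {a b} {A : Set a} {B : Set b} (f : A → List B) xs → length (concatMap f xs) ≡ ∑ (λ x → length (f x)) xs
length-concatMap f []       = refl
length-concatMap f (x ∷ xs) = trans (length-++ (f x)) (cong (length (f x) +_) (length-concatMap f xs))

nonempty-∈ : ∀ {a} {A : Set a} {xs : List A} → 1 ≤ length xs → ∃[ x ] x ∈ₗ xs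
nonempty-∈ {xs = x ∷ _} _ = x , here refl

-- Subsets

infix 4 _≟ₛ_
_≟ₛ_ : ∀ {k} → DecidableEquality (Subset k)
_≟ₛ_ = ≡-dec Bool._≟_

x∈p─q⇒x∉q : ∀ {k} (p q : Subset k) {x} → x ∈ p ─ q → x ∉ q
x∈p─q⇒x∉q (inside ∷ p)  (outside ∷ q) Vec.here        = λ ()
x∈p─q⇒x∉q (outside ∷ p) (outside ∷ q) {zero} ()
x∈p─q⇒x∉q (_ ∷ p)       (inside ∷ q)  {zero} ()
x∈p─q⇒x∉q (_ ∷ p)       (_ ∷ q)       (Vec.there x∈) = λ x∈q → x∈p─q⇒x∉q p q x∈ (drop-there x∈q)

x∉p-x : ∀ {k} (p : Subset k) x → x ∉ p - x
x∉p-x p x x∈p-x = x∈p─q⇒x∉q p ⁅ x ⁆ x∈p-x (x∈⁅x⁆ x)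

p⊆q⇒p-x⊆q-x : ∀ {k} {p q : Subset k} x → p ⊆ q → p - x ⊆ q - x
p⊆q⇒p-x⊆q-x {p = p} x p⊆q y∈p-x = x∈p∧x∉q⇒x∈p─q (p⊆q (p─q⊆p p ⁅ x ⁆ y∈p-x)) (x∈p─q⇒x∉q p ⁅ x ⁆ y∈p-x)

p≡p∩q∪p─q : ∀ {k} (p q : Subset k) → p ≡ (p ∩ q) ∪ (p ─ q)
p≡p∩q∪p─q p q = ⊆-antisym split join
  where
  split : p ⊆ (p ∩ q) ∪ (p ─ q)
  split {x} x∈p with x ∈? q
  ... | yes x∈q = x∈p∪q⁺ (inj₁ (x∈p∩q⁺ (x∈p , x∈q)))
  ... | no  x∉q = x∈p∪q⁺ (inj₂ (x∈p∧x∉q⇒x∈p─q x∈p x∉q))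
  join : (p ∩ q) ∪ (p ─ q) ⊆ p
  join x∈ with x∈p∪q⁻ (p ∩ q) (p ─ q) x∈
  ... | inj₁ x∈p∩q = proj₁ (x∈p∩q⁻ p q x∈p∩q)
  ... | inj₂ x∈p─q = p─q⊆p p q x∈p─q

p∪⁅x⁆-x≡p : ∀ {k} {p : Subset k} {x} → x ∉ p → (p ∪ ⁅ x ⁆) - x ≡ p
p∪⁅x⁆-x≡p {p = p} {x} x∉p = ⊆-antisym shrink grow
  where
  shrink : (p ∪ ⁅ x ⁆) - x ⊆ p
  shrink y∈ with x∈p∪q⁻ p ⁅ x ⁆ (p─q⊆p (p ∪ ⁅ x ⁆) ⁅ x ⁆ y∈)
  ... | inj₁ y∈p   = y∈p
  ... | inj₂ y∈⁅x⁆ = ⊥-elim (x∈p─q⇒x∉q (p ∪ ⁅ x ⁆) ⁅ x ⁆ y∈ y∈⁅x⁆)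
  grow : p ⊆ (p ∪ ⁅ x ⁆) - x
  grow {y} y∈p = x∈p∧x∉q⇒x∈p─q (p⊆p∪q ⁅ x ⁆ y∈p) (x≢y⇒x∉⁅y⁆ (λ y≡x → x∉p (subst (_∈ p) y≡x y∈p)))

⊆⇒∩≡ : ∀ {k} {p q : Subset k} → q ⊆ p → p ∩ q ≡ q
⊆⇒∩≡ {p = p} {q} q⊆p = ⊆-antisym (p∩q⊆q p q) (λ x∈q → x∈p∩q⁺ (q⊆p x∈q , x∈q))

⊆-⋃ : ∀ {k} {A : Subset k} {xs} → A ∈ₗ xs → A ⊆ ⋃ xs
⊆-⋃ {xs = A ∷ xs} (here refl) = p⊆p∪q (⋃ xs)
⊆-⋃ {xs = B ∷ xs} (there A∈xs) = λ x∈A → q⊆p∪q B (⋃ xs) (⊆-⋃ A∈xs x∈A)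

∈-⋃⁻ : ∀ {k} {x : Fin k} xs → x ∈ ⋃ xs → ∃[ A ] (A ∈ₗ xs × x ∈ A)
∈-⋃⁻ []       x∈∅ = ⊥-elim (∉⊥ x∈∅)
∈-⋃⁻ (A ∷ xs) x∈⋃ with x∈p∪q⁻ A (⋃ xs) x∈⋃
... | inj₁ x∈A  = A , here refl , x∈A
... | inj₂ x∈⋃′ = let (B , B∈xs , x∈B) = ∈-⋃⁻ xs x∈⋃′ in B , there B∈xs , x∈B

∈⇒1≤∣∣ : ∀ {k} {p : Subset k} {x} → x ∈ p → 1 ≤ ∣ p ∣
∈⇒1≤∣∣ {x = x} x∈p = subst (_≤ _) (∣⁅x⁆∣≡1 x) (p⊆q⇒∣p∣≤∣q∣ (λ y∈⁅x⁆ → subst (_∈ _) (sym (x∈⁅y⁆⇒x≡y x y∈⁅x⁆)) x∈p))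

∣p∣≡0⇒p≡∅ : ∀ {k} (p : Subset k) → ∣ p ∣ ≡ 0 → p ≡ ∅
∣p∣≡0⇒p≡∅ []            _  = refl
∣p∣≡0⇒p≡∅ (outside ∷ p) eq = cong (outside ∷_) (∣p∣≡0⇒p≡∅ p eq)

∣p∣≡1⇒p≡⁅x⁆ : ∀ {k} (p : Subset k) → ∣ p ∣ ≡ 1 → ∃[ x ] p ≡ ⁅ x ⁆
∣p∣≡1⇒p≡⁅x⁆ (inside ∷ p)  eq = zero , cong (inside ∷_) (∣p∣≡0⇒p≡∅ p (suc-injective eq))
∣p∣≡1⇒p≡⁅x⁆ (outside ∷ p) eq = let (x , p≡⁅x⁆) = ∣p∣≡1⇒p≡⁅x⁆ p eq in suc x , cong (outside ∷_) p≡⁅x⁆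

∣p─q∣+∣q∣≡∣p∣ : ∀ {k} (p q : Subset k) → q ⊆ p → ∣ p ─ q ∣ + ∣ q ∣ ≡ ∣ p ∣
∣p─q∣+∣q∣≡∣p∣ []            []            _   = refl
∣p─q∣+∣q∣≡∣p∣ (inside ∷ p)  (inside ∷ q)  q⊆p = trans (+-suc _ _) (cong suc (∣p─q∣+∣q∣≡∣p∣ p q (drop-∷-⊆ q⊆p)))
∣p─q∣+∣q∣≡∣p∣ (inside ∷ p)  (outside ∷ q) q⊆p = cong suc (∣p─q∣+∣q∣≡∣p∣ p q (drop-∷-⊆ q⊆p))
∣p─q∣+∣q∣≡∣p∣ (outside ∷ p) (outside ∷ q) q⊆p = ∣p─q∣+∣q∣≡∣p∣ p q (drop-∷-⊆ q⊆p)
∣p─q∣+∣q∣≡∣p∣ (outside ∷ p) (inside ∷ q)  q⊆p with q⊆p Vec.here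
... | ()

∣p∣≡𝟙+∣p∣∸1 : ∀ {k} (p : Subset k) → ∣ p ∣ ≡ 𝟙 (does (nonempty? p)) + (∣ p ∣ ∸ 1)
∣p∣≡𝟙+∣p∣∸1 {k} p with nonempty? p
... | yes (x , x∈p) = sym (m+[n∸m]≡n (∈⇒1≤∣∣ x∈p))
... | no  empty rewrite Empty-unique empty | ∣⊥∣≡0 k = refl

χ : ∀ {k} → Subset k → Fin k → ℕ
χ A i = 𝟙 (does (i ∈? A))

χ-∈ : ∀ {k} {A : Subset k} {i} → i ∈ A → χ A i ≡ 1
χ-∈ {A = A} {i} i∈A = cong 𝟙 (dec-true (i ∈? A) i∈A)

χ-∉ : ∀ {k} {A : Subset k} {i} → i ∉ A → χ A i ≡ 0
χ-∉ {A = A} {i} i∉A = cong 𝟙 (dec-false (i ∈? A) i∉A)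

χ-mono : ∀ {k} {A : Subset k} {i j} → (i ∈ A → j ∈ A) → χ A i ≤ χ A j
χ-mono {A = A} {i} i∈A⇒j∈A with i ∈? A
... | yes i∈A = ≤-reflexive (sym (χ-∈ (i∈A⇒j∈A i∈A)))
... | no  _   = z≤n

χ-∩ : ∀ {k} (A B : Subset k) i → χ (A ∩ B) i ≡ χ A i * χ B i
χ-∩ A B i with i ∈? A | i ∈? B
... | yes i∈A | yes i∈B = χ-∈ (x∈p∩q⁺ (i∈A , i∈B))
... | no i∉A  | _       = χ-∉ (λ i∈A∩B → i∉A (proj₁ (x∈p∩q⁻ A B i∈A∩B)))
... | yes _   | no i∉B  = χ-∉ (λ i∈A∩B → i∉B (proj₂ (x∈p∩q⁻ A B i∈A∩B)))

∣∣≡∑χ : ∀ {k} (A : Subset k) → ∣ A ∣ ≡ ∑ (χ A) (allFin k)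
∣∣≡∑χ []            = refl
∣∣≡∑χ (inside ∷ A)  = trans (cong suc (∣∣≡∑χ A)) (sym (∑-allFin-suc (χ (inside ∷ A))))
∣∣≡∑χ (outside ∷ A) = trans (∣∣≡∑χ A) (sym (∑-allFin-suc (χ (outside ∷ A))))

double-counting : ∀ {k} (X : Subset k) (xs : List (Subset k)) →
                  ∑ (λ A → ∣ A ∩ X ∣) xs ≡ ∑ (λ i → χ X i * ∑ (λ A → χ A i) xs) (allFin k)
double-counting {k} X xs = begin
  ∑ (λ A → ∣ A ∩ X ∣) xs                           ≡⟨ ∑-cong xs (λ {A} _ → ∣A∩X∣≡∑ A) ⟩
  ∑ (λ A → ∑ (λ i → χ X i * χ A i) (allFin k)) xs ≡⟨ ∑-swap (λ A i → χ X i * χ A i) xs (allFin k) ⟩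
  ∑ (λ i → ∑ (λ A → χ X i * χ A i) xs) (allFin k) ≡⟨ ∑-cong (allFin k) (λ {i} _ → ∑-*ˡ (χ X i) (λ A → χ A i) xs) ⟩
  ∑ (λ i → χ X i * ∑ (λ A → χ A i) xs) (allFin k) ∎
  where
  open ≡-Reasoning
  ∣A∩X∣≡∑ : ∀ A → ∣ A ∩ X ∣ ≡ ∑ (λ i → χ X i * χ A i) (allFin k)
  ∣A∩X∣≡∑ A = trans (∣∣≡∑χ (A ∩ X)) (∑-cong (allFin k) (λ {i} _ → trans (χ-∩ A X i) (*-comm (χ A i) (χ X i))))

module _ {k p} {P : Fin k → Set p} (P? : Decidable P) where

  ⟦_⟧ : Subset k
  ⟦_⟧ = Vec.tabulate (λ i → does (P? i))

  ∈⟦⟧⁻ : ∀ {i} → i ∈ ⟦_⟧ → P i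
  ∈⟦⟧⁻ {i} i∈ with P? i | trans (sym (lookup∘tabulate (λ j → does (P? j)) i)) ([]=⇒lookup i∈)
  ... | yes Pi | _  = Pi
  ... | no  _  | ()

  ∈⟦⟧⁺ : ∀ {i} → P i → i ∈ ⟦_⟧
  ∈⟦⟧⁺ {i} Pi = lookup⇒[]= i ⟦_⟧ (trans (lookup∘tabulate (λ j → does (P? j)) i) (dec-true (P? i) Pi))

elements : ∀ {k} → Subset k → List (Fin k)
elements {k} A = filter (_∈? A) (allFin k)

length-elements : ∀ {k} (A : Subset k) → length (elements A) ≡ ∣ A ∣
length-elements {k} A = trans (length-filter≡∑ (_∈? A) (allFin k)) (sym (∣∣≡∑χ A))

∈-elements⁻ : ∀ {k} {A : Subset k} {x} → x ∈ₗ elements A → x ∈ A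
∈-elements⁻ {k} {A} x∈ = proj₂ (∈-filter⁻ (_∈? A) {xs = allFin k} x∈)

∈-elements⁺ : ∀ {k} {A : Subset k} {x} → x ∈ A → x ∈ₗ elements A
∈-elements⁺ {A = A} x∈A = ∈-filter⁺ (_∈? A) (∈-allFin _) x∈A

elements-unique : ∀ {k} (A : Subset k) → Unique (elements A)
elements-unique {k} A = Unique.filter⁺ (_∈? A) (Unique.allFin⁺ k)

subsetsOf : ∀ {k} → Subset k → List (Subset k)
subsetsOf []            = [] ∷ []
subsetsOf (inside ∷ S)  = map (inside ∷_) (subsetsOf S) ++ map (outside ∷_) (subsetsOf S)
subsetsOf (outside ∷ S) = map (outside ∷_) (subsetsOf S)

∈-subsetsOf⁻ : ∀ {k} (S : Subset k) {R} → R ∈ₗ subsetsOf S → R ⊆ S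
∈-subsetsOf⁻ [] (here refl) = λ ()
∈-subsetsOf⁻ (inside ∷ S) R∈ with ∈-++⁻ (map (inside ∷_) (subsetsOf S)) R∈
... | inj₁ R∈₁ with ∈-map⁻ (inside ∷_) R∈₁
...   | R , R∈S , refl = in⊆in (∈-subsetsOf⁻ S R∈S)
∈-subsetsOf⁻ (inside ∷ S) R∈ | inj₂ R∈₂ with ∈-map⁻ (outside ∷_) R∈₂
...   | R , R∈S , refl = out⊆ (∈-subsetsOf⁻ S R∈S)
∈-subsetsOf⁻ (outside ∷ S) R∈ with ∈-map⁻ (outside ∷_) R∈
... | R , R∈S , refl = out⊆ (∈-subsetsOf⁻ S R∈S)

∈-subsetsOf⁺ : ∀ {k} (S : Subset k) {R} → R ⊆ S → R ∈ₗ subsetsOf S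
∈-subsetsOf⁺ []            {[]}          _ = here refl
∈-subsetsOf⁺ (inside ∷ S)  {inside ∷ R}  R⊆S = ∈-++⁺ˡ (∈-map⁺ (inside ∷_) (∈-subsetsOf⁺ S (drop-∷-⊆ R⊆S)))
∈-subsetsOf⁺ (inside ∷ S)  {outside ∷ R} R⊆S =
  ∈-++⁺ʳ (map (inside ∷_) (subsetsOf S)) (∈-map⁺ (outside ∷_) (∈-subsetsOf⁺ S (drop-∷-⊆ R⊆S)))
∈-subsetsOf⁺ (outside ∷ S) {inside ∷ R}  R⊆S with R⊆S Vec.here
... | ()
∈-subsetsOf⁺ (outside ∷ S) {outside ∷ R} R⊆S = ∈-map⁺ (outside ∷_) (∈-subsetsOf⁺ S (drop-∷-⊆ R⊆S))

subsetsOf-unique : ∀ {k} (S : Subset k) → Unique (subsetsOf S)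
subsetsOf-unique []            = [] ∷ []
subsetsOf-unique (inside ∷ S)  =
  Unique.++⁺ (Unique.map⁺ ∷-injectiveʳ (subsetsOf-unique S)) (Unique.map⁺ ∷-injectiveʳ (subsetsOf-unique S)) disjoint
  where
  disjoint : Disjoint (map (inside ∷_) (subsetsOf S)) (map (outside ∷_) (subsetsOf S))
  disjoint (R∈₁ , R∈₂) with ∈-map⁻ (inside ∷_) R∈₁ | ∈-map⁻ (outside ∷_) R∈₂
  ... | _ , _ , refl | _ , _ , ()
subsetsOf-unique (outside ∷ S) = Unique.map⁺ ∷-injectiveʳ (subsetsOf-unique S)

∑-subsetsOf-inside : ∀ {k} (S : Subset k) (f : Subset (suc k) → ℕ) →
  ∑ f (subsetsOf (inside ∷ S)) ≡ ∑ (λ R → f (inside ∷ R)) (subsetsOf S) + ∑ (λ R → f (outside ∷ R)) (subsetsOf S)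
∑-subsetsOf-inside S f = trans (∑-++ f (map (inside ∷_) (subsetsOf S)) (map (outside ∷_) (subsetsOf S)))
                               (cong₂ _+_ (∑-map f (inside ∷_) (subsetsOf S)) (∑-map f (outside ∷_) (subsetsOf S)))

length-subsetsOf : ∀ {k} (S : Subset k) → length (subsetsOf S) ≡ 2 ^ ∣ S ∣
length-subsetsOf []            = refl
length-subsetsOf (inside ∷ S)  = begin
  length (map (inside ∷_) (subsetsOf S) ++ map (outside ∷_) (subsetsOf S))
    ≡⟨ length-++ (map (inside ∷_) (subsetsOf S)) ⟩
  length (map (inside ∷_) (subsetsOf S)) + length (map (outside ∷_) (subsetsOf S))
    ≡⟨ cong₂ _+_ (length-map (inside ∷_) (subsetsOf S)) (length-map (outside ∷_) (subsetsOf S)) ⟩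
  length (subsetsOf S) + length (subsetsOf S)
    ≡⟨ cong (λ l → l + l) (length-subsetsOf S) ⟩
  2 ^ ∣ S ∣ + 2 ^ ∣ S ∣
    ≡⟨ cong (2 ^ ∣ S ∣ +_) (sym (+-identityʳ _)) ⟩
  2 * 2 ^ ∣ S ∣ ∎
  where open ≡-Reasoning
length-subsetsOf (outside ∷ S) = trans (length-map (outside ∷_) (subsetsOf S)) (length-subsetsOf S)

∑-∣∣-subsetsOf : ∀ {k} (S : Subset k) → 2 * ∑ ∣_∣ (subsetsOf S) ≡ ∣ S ∣ * 2 ^ ∣ S ∣
∑-∣∣-subsetsOf []            = refl
∑-∣∣-subsetsOf (inside ∷ S)  = begin
  2 * ∑ ∣_∣ (subsetsOf (inside ∷ S))                         ≡⟨ cong (2 *_) (∑-subsetsOf-inside S ∣_∣) ⟩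
  2 * (∑ (λ R → 1 + ∣ R ∣) (subsetsOf S) + ∑ ∣_∣ (subsetsOf S)) ≡⟨ cong (λ x → 2 * (x + ∑ ∣_∣ (subsetsOf S))) ∑1+ ⟩
  2 * (2 ^ ∣ S ∣ + ∑ ∣_∣ (subsetsOf S) + ∑ ∣_∣ (subsetsOf S))
    ≡⟨ step (2 ^ ∣ S ∣) (∑ ∣_∣ (subsetsOf S)) ∣ S ∣ (∑-∣∣-subsetsOf S) ⟩
  suc ∣ S ∣ * 2 ^ suc ∣ S ∣                                  ∎
  where
  open ≡-Reasoning
  ∑1+ : ∑ (λ R → 1 + ∣ R ∣) (subsetsOf S) ≡ 2 ^ ∣ S ∣ + ∑ ∣_∣ (subsetsOf S)
  ∑1+ = trans (∑-+ (λ _ → 1) ∣_∣ (subsetsOf S))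
              (cong (_+ ∑ ∣_∣ (subsetsOf S)) (trans (∑-const 1 (subsetsOf S)) (trans (*-identityˡ _) (length-subsetsOf S))))
  step : ∀ p x s → 2 * x ≡ s * p → 2 * (p + x + x) ≡ suc s * (2 * p)
  step p x s eq = begin
    2 * (p + x + x)       ≡⟨ expand p x ⟩
    2 * p + 2 * x + 2 * x ≡⟨ cong (λ y → 2 * p + y + y) eq ⟩
    2 * p + s * p + s * p ≡⟨ collect p s ⟩
    suc s * (2 * p)       ∎
    where
    expand : ∀ p x → 2 * (p + x + x) ≡ 2 * p + 2 * x + 2 * x
    expand = solve-∀
    collect : ∀ p s → 2 * p + s * p + s * p ≡ suc s * (2 * p)
    collect = solve-∀
∑-∣∣-subsetsOf (outside ∷ S) = trans (cong (2 *_) (∑-map ∣_∣ (outside ∷_) (subsetsOf S))) (∑-∣∣-subsetsOf S)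

∑-∣∣∸1-subsetsOf : ∀ {k} (S : Subset k) →
  2 * ∑ (λ R → ∣ R ∣ ∸ 1) (subsetsOf S) + 2 ^ suc ∣ S ∣ ≡ ∣ S ∣ * 2 ^ ∣ S ∣ + 2
∑-∣∣∸1-subsetsOf []            = refl
∑-∣∣∸1-subsetsOf (inside ∷ S)  = begin
  2 * ∑ (λ R → ∣ R ∣ ∸ 1) (subsetsOf (inside ∷ S)) + 2 ^ suc (suc ∣ S ∣)
    ≡⟨ cong (λ x → 2 * x + 2 ^ suc (suc ∣ S ∣)) (∑-subsetsOf-inside S (λ R → ∣ R ∣ ∸ 1)) ⟩
  2 * (∑ ∣_∣ (subsetsOf S) + ∑ (λ R → ∣ R ∣ ∸ 1) (subsetsOf S)) + 2 * (2 * 2 ^ ∣ S ∣)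
    ≡⟨ step (2 ^ ∣ S ∣) (∑ ∣_∣ (subsetsOf S)) (∑ (λ R → ∣ R ∣ ∸ 1) (subsetsOf S)) ∣ S ∣
                  (∑-∣∣-subsetsOf S) (∑-∣∣∸1-subsetsOf S) ⟩
  suc ∣ S ∣ * 2 ^ suc ∣ S ∣ + 2 ∎
  where
  open ≡-Reasoning
  step : ∀ p x y s → 2 * x ≡ s * p → 2 * y + 2 * p ≡ s * p + 2 → 2 * (x + y) + 2 * (2 * p) ≡ suc s * (2 * p) + 2
  step p x y s eq₁ eq₂ = begin
    2 * (x + y) + 2 * (2 * p)         ≡⟨ expand x y p ⟩
    2 * x + (2 * y + 2 * p) + 2 * p   ≡⟨ cong₂ (λ a b → a + b + 2 * p) eq₁ eq₂ ⟩
    s * p + (s * p + 2) + 2 * p       ≡⟨ collect s p ⟩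
    suc s * (2 * p) + 2               ∎
    where
    expand : ∀ x y p → 2 * (x + y) + 2 * (2 * p) ≡ 2 * x + (2 * y + 2 * p) + 2 * p
    expand = solve-∀
    collect : ∀ s p → s * p + (s * p + 2) + 2 * p ≡ suc s * (2 * p) + 2
    collect = solve-∀
∑-∣∣∸1-subsetsOf (outside ∷ S) =
  trans (cong (λ x → 2 * x + 2 ^ suc ∣ S ∣) (∑-map (λ R → ∣ R ∣ ∸ 1) (outside ∷_) (subsetsOf S))) (∑-∣∣∸1-subsetsOf S)

module _ {k p} {P : Subset k → Set p} (P? : Decidable P) (P-mono : ∀ {X Y} → X ⊆ Y → P X → P Y) where

  private
    shrinkBy : List (Fin k) → Subset k → Subset k
    shrinkBy []       X = X
    shrinkBy (i ∷ is) X with P? (X - i)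
    ... | yes _ = shrinkBy is (X - i)
    ... | no  _ = shrinkBy is X

    shrinkBy-⊆ : ∀ is X → shrinkBy is X ⊆ X
    shrinkBy-⊆ []       X = λ x∈ → x∈
    shrinkBy-⊆ (i ∷ is) X with P? (X - i)
    ... | yes _ = λ x∈ → p─q⊆p X ⁅ i ⁆ (shrinkBy-⊆ is (X - i) x∈)
    ... | no  _ = shrinkBy-⊆ is X

    shrinkBy-P : ∀ is X → P X → P (shrinkBy is X)
    shrinkBy-P []       X PX = PX
    shrinkBy-P (i ∷ is) X PX with P? (X - i)
    ... | yes PX-i = shrinkBy-P is (X - i) PX-i
    ... | no  _    = shrinkBy-P is X PX

    shrinkBy-minimal : ∀ is X {i} → i ∈ₗ is → i ∈ shrinkBy is X → ¬ P (shrinkBy is X - i)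
    shrinkBy-minimal (j ∷ is) X (there i∈is) with P? (X - j)
    ... | yes _ = shrinkBy-minimal is (X - j) i∈is
    ... | no  _ = shrinkBy-minimal is X i∈is
    shrinkBy-minimal (i ∷ is) X (here refl) i∈Y with P? (X - i)
    ... | yes _    = ⊥-elim (x∉p-x X i (shrinkBy-⊆ is (X - i) i∈Y))
    ... | no ¬PX-i = λ PY-i → ¬PX-i (P-mono (p⊆q⇒p-x⊆q-x i (shrinkBy-⊆ is X)) PY-i)

  minimal-⊆ : ∀ {X} → P X → ∃[ Y ] (Y ⊆ X × P Y × (∀ {i} → i ∈ Y → ¬ P (Y - i)))
  minimal-⊆ {X} PX = shrinkBy (allFin k) X , shrinkBy-⊆ (allFin k) X , shrinkBy-P (allFin k) X PX ,
                     shrinkBy-minimal (allFin k) X (∈-allFin _)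

-- Union-closed separating families

module UnionClosedFamily {k} (𝒜 : Family k) (uc : UnionClosed 𝒜) (sep : Separating 𝒜) where

  U : Subset k
  U = universe 𝒜

  ⋃-closed : ∀ {xs A} → A ∈ₗ xs → (∀ {B} → B ∈ₗ xs → B ∈ₗ sets 𝒜) → ⋃ xs ∈ₗ sets 𝒜
  ⋃-closed {B ∷ []}     _ xs⊆𝒜 = subst (_∈ₗ sets 𝒜) (sym (∪-identityʳ B)) (xs⊆𝒜 (here refl))
  ⋃-closed {B ∷ C ∷ xs} _ xs⊆𝒜 = uc (xs⊆𝒜 (here refl)) (⋃-closed (here refl) (xs⊆𝒜 ∘ there))

  universe-∈ : NonEmptyFamily 𝒜 → U ∈ₗ sets 𝒜
  universe-∈ ne = ⋃-closed (proj₂ (nonempty-∈ ne)) id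

  ⊆-universe : ∀ {A} → A ∈ₗ sets 𝒜 → A ⊆ U
  ⊆-universe = ⊆-⋃

  frequency≡∑χ : ∀ x → frequency 𝒜 x ≡ ∑ (λ A → χ A x) (sets 𝒜)
  frequency≡∑χ x = length-filter≡∑ (x ∈?_) (sets 𝒜)

  module _ {p} {P : Subset k → Set p} (P? : Decidable P) where

    ⋃-filter-∈ : ∀ {A} → A ∈ₗ sets 𝒜 → P A → ⋃ (filter P? (sets 𝒜)) ∈ₗ sets 𝒜
    ⋃-filter-∈ A∈𝒜 PA = ⋃-closed (∈-filter⁺ P? A∈𝒜 PA) (proj₁ ∘ ∈-filter⁻ P?)

    ⊆-⋃-filter : ∀ {A} → A ∈ₗ sets 𝒜 → P A → A ⊆ ⋃ (filter P? (sets 𝒜))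
    ⊆-⋃-filter A∈𝒜 PA = ⊆-⋃ (∈-filter⁺ P? A∈𝒜 PA)

    ∈-⋃-filter⁻ : ∀ {x} → x ∈ ⋃ (filter P? (sets 𝒜)) → ∃[ A ] (A ∈ₗ sets 𝒜 × P A × x ∈ A)
    ∈-⋃-filter⁻ x∈ = let (A , A∈ , x∈A) = ∈-⋃⁻ (filter P? (sets 𝒜)) x∈
                         (A∈𝒜 , PA) = ∈-filter⁻ P? A∈ in A , A∈𝒜 , PA , x∈A

  largestAvoiding : Fin k → Subset k
  largestAvoiding y = ⋃ (filter (λ A → ¬? (y ∈? A)) (sets 𝒜))

  largestAvoiding-∈ : ∀ {y} → frequency 𝒜 y < size 𝒜 → largestAvoiding y ∈ₗ sets 𝒜
  largestAvoiding-∈ {y} lt = let (A , A∈𝒜 , y∉A) = ∃-∉-filter (y ∈?_) (sets 𝒜) lt in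
    ⋃-filter-∈ (λ A → ¬? (y ∈? A)) A∈𝒜 y∉A

  ⊆-largestAvoiding : ∀ {y A} → A ∈ₗ sets 𝒜 → y ∉ A → A ⊆ largestAvoiding y
  ⊆-largestAvoiding {y} = ⊆-⋃-filter (λ A → ¬? (y ∈? A))

  ∉-largestAvoiding : ∀ y → y ∉ largestAvoiding y
  ∉-largestAvoiding y y∈ = let (_ , _ , y∉A , y∈A) = ∈-⋃-filter⁻ (λ A → ¬? (y ∈? A)) y∈ in y∉A y∈A

  largestAvoiding-injective : ∀ {y z} → y ∈ U → z ∈ U → largestAvoiding y ≡ largestAvoiding z → y ≡ z
  largestAvoiding-injective {y} {z} y∈U z∈U eq with y Fin.≟ z
  ... | yes y≡z = y≡z
  ... | no  y≢z with sep y∈U z∈U y≢z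
  ...   | A , A∈𝒜 , inj₁ (y∈A , z∉A) = ⊥-elim (∉-largestAvoiding y (subst (y ∈_) (sym eq) (⊆-largestAvoiding A∈𝒜 z∉A y∈A)))
  ...   | A , A∈𝒜 , inj₂ (z∈A , y∉A) = ⊥-elim (∉-largestAvoiding z (subst (z ∈_) eq (⊆-largestAvoiding A∈𝒜 y∉A z∈A)))

  Separates : Fin k → Fin k → Set
  Separates t y = Any (λ A → t ∈ A × y ∉ A) (sets 𝒜)

  separates? : ∀ t y → Dec (Separates t y)
  separates? t y = Any.any? (λ A → t ∈? A ×-dec ¬? (y ∈? A)) (sets 𝒜)

  -- t is a minimal element of U for the preorder "every member containing t contains y".
  Minimal : Fin k → Set
  Minimal t = t ∈ U × (∀ y → y ∈ U → y ≢ t → Separates t y)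

  minimal? : Decidable Minimal
  minimal? t = t ∈? U ×-dec all? (λ y → y ∈? U →-dec ¬? (y Fin.≟ t) →-dec separates? t y)

  dominating : ∀ {x} → x ∈ U → ¬ Minimal x → ∃[ y ] (y ∈ U × y ≢ x × (∀ {A} → A ∈ₗ sets 𝒜 → x ∈ A → y ∈ A))
  dominating {x} x∈U ¬min = dominator (¬∀⟶∃¬ k _ (λ y → y ∈? U →-dec ¬? (y Fin.≟ x) →-dec separates? x y) (¬min ∘ (x∈U ,_)))
    where
    dominator : ∃[ y ] ¬ (y ∈ U → y ≢ x → Separates x y) → ∃[ y ] (y ∈ U × y ≢ x × (∀ {A} → A ∈ₗ sets 𝒜 → x ∈ A → y ∈ A))
    dominator (y , ¬sep) with y ∈? U | y Fin.≟ x | separates? x y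
    ... | no y∉U  | _        | _        = ⊥-elim (¬sep (λ y∈U → ⊥-elim (y∉U y∈U)))
    ... | yes _   | yes y≡x  | _        = ⊥-elim (¬sep (λ _ y≢x → ⊥-elim (y≢x y≡x)))
    ... | yes _   | no _     | yes sepx = ⊥-elim (¬sep (λ _ _ → sepx))
    ... | yes y∈U | no y≢x   | no ¬sepx = y , y∈U , y≢x , contains
      where
      contains : ∀ {A} → A ∈ₗ sets 𝒜 → x ∈ A → y ∈ A
      contains {A} A∈𝒜 x∈A with y ∈? A
      ... | yes y∈A = y∈A
      ... | no  y∉A = ⊥-elim (¬sepx (lose A∈𝒜 (x∈A , y∉A)))

  minimal-separates : ∀ {t y} → Minimal t → y ∈ U → y ≢ t → ∃[ A ] (A ∈ₗ sets 𝒜 × t ∈ A × y ∉ A)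
  minimal-separates {y = y} (_ , separated) y∈U y≢t = find (separated y y∈U y≢t)

  frequency≤size : ∀ x → frequency 𝒜 x ≤ size 𝒜
  frequency≤size x = length-filter (x ∈?_) (sets 𝒜)

  frequency-< : ∀ {x y} → x ∈ U → y ∈ U → y ≢ x → (∀ {A} → A ∈ₗ sets 𝒜 → x ∈ A → y ∈ A) →
                frequency 𝒜 x < frequency 𝒜 y
  frequency-< {x} {y} x∈U y∈U y≢x dom with sep y∈U x∈U y≢x
  ... | A , A∈𝒜 , inj₂ (x∈A , y∉A) = ⊥-elim (y∉A (dom A∈𝒜 x∈A))
  ... | A , A∈𝒜 , inj₁ (y∈A , x∉A) = subst₂ _<_ (sym (frequency≡∑χ x)) (sym (frequency≡∑χ y))
    (∑-mono-< (sets 𝒜) (λ B∈𝒜 → χ-mono (dom B∈𝒜)) A∈𝒜 (subst₂ _<_ (sym (χ-∉ x∉A)) (sym (χ-∈ y∈A)) ≤-refl))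

  minimal-∈ : ∀ {A x} → A ∈ₗ sets 𝒜 → x ∈ A → ∃[ t ] (Minimal t × t ∈ A)
  minimal-∈ {A} A∈𝒜 = descend (On.wellFounded (λ x → size 𝒜 ∸ frequency 𝒜 x) <-wellFounded _)
    where
    descend : ∀ {x} → Acc (λ y x → size 𝒜 ∸ frequency 𝒜 y < size 𝒜 ∸ frequency 𝒜 x) x → x ∈ A → ∃[ t ] (Minimal t × t ∈ A)
    descend {x} (acc rs) x∈A with minimal? x
    ... | yes min = x , min , x∈A
    ... | no ¬min = let x∈U = ⊆-universe A∈𝒜 x∈A
                        (y , y∈U , y≢x , dom) = dominating x∈U ¬min in
      descend (rs (∸-monoʳ-< (frequency-< x∈U y∈U y≢x dom) (frequency≤size y))) (dom A∈𝒜 x∈A)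

  Transversal : Subset k → Set
  Transversal X = All (λ A → Nonempty A → Nonempty (A ∩ X)) (sets 𝒜)

  transversal? : Decidable Transversal
  transversal? X = All.all? (λ A → nonempty? A →-dec nonempty? (A ∩ X)) (sets 𝒜)

  transversal-mono : ∀ {X Y} → X ⊆ Y → Transversal X → Transversal Y
  transversal-mono {X} {Y} X⊆Y = All.map widen
    where
    widen : ∀ {A} → (Nonempty A → Nonempty (A ∩ X)) → Nonempty A → Nonempty (A ∩ Y)
    widen {A} meets ne = let (x , x∈A∩X) = meets ne
                             (x∈A , x∈X) = x∈p∩q⁻ A X x∈A∩X in x , x∈p∩q⁺ (x∈A , X⊆Y x∈X)

  minimals-transversal : Transversal ⟦ minimal? ⟧
  minimals-transversal = All.tabulate (λ A∈𝒜 (x , x∈A) → let (t , min , t∈A) = minimal-∈ A∈𝒜 x∈A in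
                                                         t , x∈p∩q⁺ (t∈A , ∈⟦⟧⁺ minimal? min))

  private
    irredundantTransversal : ∃[ T ] (T ⊆ ⟦ minimal? ⟧ × Transversal T × (∀ {t} → t ∈ T → ¬ Transversal (T - t)))
    irredundantTransversal = minimal-⊆ transversal? transversal-mono minimals-transversal

  T : Subset k
  T = proj₁ irredundantTransversal

  T-minimal : ∀ {t} → t ∈ T → Minimal t
  T-minimal t∈T = ∈⟦⟧⁻ minimal? (proj₁ (proj₂ irredundantTransversal) t∈T)

  T-transversal : Transversal T
  T-transversal = proj₁ (proj₂ (proj₂ irredundantTransversal))

  T-irredundant : ∀ {t} → t ∈ T → ¬ Transversal (T - t)
  T-irredundant = proj₂ (proj₂ (proj₂ irredundantTransversal))

  T⊆U : T ⊆ U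
  T⊆U t∈T = proj₁ (T-minimal t∈T)

  privateMember : ∀ {t} → t ∈ T → ∃[ B ] (B ∈ₗ sets 𝒜 × B ∩ T ≡ ⁅ t ⁆)
  privateMember {t} t∈T with find (¬All⇒Any¬ (λ A → nonempty? A →-dec nonempty? (A ∩ (T - t))) (sets 𝒜) (T-irredundant t∈T))
  ... | B , B∈𝒜 , ¬meets = B , B∈𝒜 , ⊆-antisym B∩T⊆⁅t⁆ ⁅t⁆⊆B∩T
    where
    B∩T⊆⁅t⁆ : B ∩ T ⊆ ⁅ t ⁆
    B∩T⊆⁅t⁆ {y} y∈B∩T with y Fin.≟ t
    ... | yes refl = x∈⁅x⁆ y
    ... | no  y≢t  = let (y∈B , y∈T) = x∈p∩q⁻ B T y∈B∩T in
                     ⊥-elim (¬meets (λ _ → y , x∈p∩q⁺ (y∈B , x∈p∧x≢y⇒x∈p-y y∈T y≢t)))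
    ⁅t⁆⊆B∩T : ⁅ t ⁆ ⊆ B ∩ T
    ⁅t⁆⊆B∩T {y} y∈⁅t⁆ with nonempty? B
    ... | no ¬ne = ⊥-elim (¬meets (λ ne → ⊥-elim (¬ne ne)))
    ... | yes ne = let (z , z∈B∩T) = All.lookup T-transversal B∈𝒜 ne in
                   subst (_∈ B ∩ T) (trans (x∈⁅y⁆⇒x≡y t (B∩T⊆⁅t⁆ z∈B∩T)) (sym (x∈⁅y⁆⇒x≡y t y∈⁅t⁆))) z∈B∩T

  trace-realised : ∀ {R} → R ⊆ T → Nonempty R → ∃[ A ] (A ∈ₗ sets 𝒜 × A ∩ T ≡ R)
  trace-realised {R} R⊆T (t , t∈R) = A , A∈𝒜 , ⊆-antisym A∩T⊆R R⊆A∩T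
    where
    -- A is the union of all members whose trace lies in R; the private members of R put R inside it.
    inside? : Decidable (λ A → A ∩ T ⊆ R)
    inside? A = A ∩ T ⊆? R
    A : Subset k
    A = ⋃ (filter inside? (sets 𝒜))
    privateMember-⊆ : ∀ {s} → s ∈ R → ∃[ B ] (B ∈ₗ sets 𝒜 × B ∩ T ⊆ R × s ∈ B)
    privateMember-⊆ {s} s∈R = let (B , B∈𝒜 , B∩T≡⁅s⁆) = privateMember (R⊆T s∈R) in
      B , B∈𝒜 ,
      (λ x∈B∩T → subst (_∈ R) (sym (x∈⁅y⁆⇒x≡y s (subst (_ ∈_) B∩T≡⁅s⁆ x∈B∩T))) s∈R) ,
      proj₁ (x∈p∩q⁻ B T (subst (s ∈_) (sym B∩T≡⁅s⁆) (x∈⁅x⁆ s)))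
    A∈𝒜 : A ∈ₗ sets 𝒜
    A∈𝒜 = let (B , B∈𝒜 , B∩T⊆R , _) = privateMember-⊆ t∈R in ⋃-filter-∈ inside? B∈𝒜 B∩T⊆R
    A∩T⊆R : A ∩ T ⊆ R
    A∩T⊆R x∈A∩T = let (x∈A , x∈T) = x∈p∩q⁻ A T x∈A∩T
                      (B , _ , B∩T⊆R , x∈B) = ∈-⋃-filter⁻ inside? x∈A in B∩T⊆R (x∈p∩q⁺ (x∈B , x∈T))
    R⊆A∩T : R ⊆ A ∩ T
    R⊆A∩T s∈R = let (B , B∈𝒜 , B∩T⊆R , s∈B) = privateMember-⊆ s∈R in
                x∈p∩q⁺ (⊆-⋃-filter inside? B∈𝒜 B∩T⊆R s∈B , R⊆T s∈R)

  singleton-frequent : ∀ {t} → ⁅ t ⁆ ∈ₗ sets 𝒜 → size 𝒜 ≤ 2 * frequency 𝒜 t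
  singleton-frequent {t} ⁅t⁆∈𝒜 = begin
    size 𝒜                                ≡⟨ size≡ ⟩
    frequency 𝒜 t + length avoiders       ≤⟨ +-monoʳ-≤ (frequency 𝒜 t) avoiders≤ ⟩
    frequency 𝒜 t + frequency 𝒜 t         ≡⟨ cong (frequency 𝒜 t +_) (sym (+-identityʳ _)) ⟩
    2 * frequency 𝒜 t                     ∎
    where
    open ≤-Reasoning
    avoiders : List (Subset k)
    avoiders = filter (¬? ∘ (t ∈?_)) (sets 𝒜)
    avoids : ∀ {A} → A ∈ₗ avoiders → A ∈ₗ sets 𝒜 × t ∉ A
    avoids = ∈-filter⁻ (¬? ∘ (t ∈?_))
    size≡ : size 𝒜 ≡ frequency 𝒜 t + length avoiders
    size≡ = trans (sym (∑1≡length (sets 𝒜)))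
                  (trans (∑-filter-partition (t ∈?_) (λ _ → 1) (sets 𝒜))
                         (cong₂ _+_ (∑1≡length (filter (t ∈?_) (sets 𝒜))) (∑1≡length avoiders)))
    avoiders-unique : Unique (map (_∪ ⁅ t ⁆) avoiders)
    avoiders-unique = Unique-map⁺ (_∪ ⁅ t ⁆) injective (Unique.filter⁺ _ (distinct 𝒜))
      where
      injective : ∀ {A B} → A ∈ₗ avoiders → B ∈ₗ avoiders → A ∪ ⁅ t ⁆ ≡ B ∪ ⁅ t ⁆ → A ≡ B
      injective A∈ B∈ eq =
        trans (sym (p∪⁅x⁆-x≡p (proj₂ (avoids A∈)))) (trans (cong (_- t) eq) (p∪⁅x⁆-x≡p (proj₂ (avoids B∈))))
    avoiders≤ : length avoiders ≤ frequency 𝒜 t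
    avoiders≤ = subst (_≤ frequency 𝒜 t) (length-map (_∪ ⁅ t ⁆) avoiders)
      (length-sublist (filter (t ∈?_) (sets 𝒜)) avoiders-unique containers)
      where
      containers : ∀ {B} → B ∈ₗ map (_∪ ⁅ t ⁆) avoiders → B ∈ₗ filter (t ∈?_) (sets 𝒜)
      containers B∈ with ∈-map⁻ (_∪ ⁅ t ⁆) B∈
      ... | A , A∈ , refl = ∈-filter⁺ (t ∈?_) (uc (proj₁ (avoids A∈)) ⁅t⁆∈𝒜) (q⊆p∪q A ⁅ t ⁆ (x∈⁅x⁆ t))

-- Counting against an irredundant transversal

-- For a transversal of size k with w = m − k elements outside it: S = Σ_A ∣A ∩ T∣,
-- G = Σ_{R ⊆ T} (∣R∣ ∸ 1), and N₀, N₁ count the members meeting T in no element and in one.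
record CountingBounds (n m k : ℕ) : Set where
  field
    w S G N₀ N₁ : ℕ
    w+k≡m    : w + k ≡ m
    S-upper  : 2 * S + k ≤ k * n
    S-lower  : n + (k ∸ 1) * suc w + G ≤ S + 1 + (k ∸ 1)
    G-eq     : 2 * G + 2 ^ suc k ≡ k * 2 ^ k + 2
    S-lower′ : 2 * n + (k ∸ 2) * suc w ≤ S + 2 * N₀ + N₁
    N₀≤1     : N₀ ≤ 1
    N₁-upper : N₁ + k ≤ k * 2 ^ w

2+x∸2≤ : ∀ x e → (x ≡ 0 → e ≡ 1) → 2 + (x ∸ 2) ≤ x + 2 * e + 𝟙 (does (x ≟ 1))
2+x∸2≤ zero          e x≡0⇒e≡1 rewrite x≡0⇒e≡1 refl = ≤-refl
2+x∸2≤ (suc zero)    e _ = subst (2 ≤_) (+-comm 1 (1 + 2 * e)) (s≤s (s≤s z≤n))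
2+x∸2≤ (suc (suc x)) e _ = ≤-trans (m≤m+n (2 + x) (2 * e)) (m≤m+n _ _)

module Counting {k} (𝒜 : Family k) (uc : UnionClosed 𝒜) (sep : Separating 𝒜) (ne : NonEmptyFamily 𝒜)
                (rare : ∀ {x} → x ∈ universe 𝒜 → 2 * frequency 𝒜 x < size 𝒜) where

  open UnionClosedFamily 𝒜 uc sep

  W : Subset k
  W = U ─ T

  ∣W∣+∣T∣≡∣U∣ : ∣ W ∣ + ∣ T ∣ ≡ ∣ U ∣
  ∣W∣+∣T∣≡∣U∣ = ∣p─q∣+∣q∣≡∣p∣ U T T⊆U

  private
    frequency<size : ∀ {x} → x ∈ U → frequency 𝒜 x < size 𝒜
    frequency<size x∈U = ≤-trans (s≤s (m≤m+n _ _)) (rare x∈U)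

  T⊆largestAvoiding : ∀ {y} → y ∈ W → T ⊆ largestAvoiding y
  T⊆largestAvoiding {y} y∈W {t} t∈T =
    let (A , A∈𝒜 , t∈A , y∉A) = minimal-separates (T-minimal t∈T) (p─q⊆p U T y∈W) y≢t in ⊆-largestAvoiding A∈𝒜 y∉A t∈A
    where
    y≢t : y ≢ t
    y≢t y≡t = x∈p─q⇒x∉q U T y∈W (subst (_∈ T) (sym y≡t) t∈T)

  fullMembers : List (Subset k)
  fullMembers = U ∷ map largestAvoiding (elements W)

  length-fullMembers : length fullMembers ≡ suc ∣ W ∣
  length-fullMembers = cong suc (trans (length-map largestAvoiding (elements W)) (length-elements W))

  fullMembers-∈ : ∀ {A} → A ∈ₗ fullMembers → A ∈ₗ sets 𝒜 × A ∩ T ≡ T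
  fullMembers-∈ (here refl) = universe-∈ ne , ⊆⇒∩≡ T⊆U
  fullMembers-∈ (there A∈) with ∈-map⁻ largestAvoiding A∈
  ... | y , y∈W , refl = largestAvoiding-∈ (frequency<size (p─q⊆p U T (∈-elements⁻ y∈W))) ,
                         ⊆⇒∩≡ (T⊆largestAvoiding (∈-elements⁻ y∈W))

  fullMembers-unique : Unique fullMembers
  fullMembers-unique = All.tabulate U≢ ∷ Unique-map⁺ largestAvoiding injective (elements-unique W)
    where
    inU : ∀ {y} → y ∈ₗ elements W → y ∈ U
    inU y∈W = p─q⊆p U T (∈-elements⁻ y∈W)
    U≢ : ∀ {A} → A ∈ₗ map largestAvoiding (elements W) → U ≢ A
    U≢ A∈ U≡A with ∈-map⁻ largestAvoiding A∈
    ... | y , y∈W , refl = ∉-largestAvoiding y (subst (y ∈_) U≡A (inU y∈W))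
    injective : ∀ {y z} → y ∈ₗ elements W → z ∈ₗ elements W → largestAvoiding y ≡ largestAvoiding z → y ≡ z
    injective y∈W z∈W = largestAvoiding-injective (inU y∈W) (inU z∈W)

  properTraces : List (Subset k)
  properTraces = filter (λ R → nonempty? R ×-dec ¬? (R ≟ₛ T)) (subsetsOf T)

  properTraces-unique : Unique properTraces
  properTraces-unique = Unique.filter⁺ _ (subsetsOf-unique T)

  ∑-traces : ∀ (φ : Subset k → ℕ) → φ T * suc ∣ W ∣ + ∑ φ properTraces ≤ ∑ (λ A → φ (A ∩ T)) (sets 𝒜)
  ∑-traces φ = begin
    φ T * suc ∣ W ∣ + ∑ φ properTraces ≤⟨ +-mono-≤ full-bound partial-bound ⟩
    ∑ φ∩T full + ∑ φ∩T partial         ≡⟨ sym (∑-filter-partition full? φ∩T (sets 𝒜)) ⟩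
    ∑ φ∩T (sets 𝒜)                     ∎
    where
    open ≤-Reasoning
    φ∩T : Subset k → ℕ
    φ∩T A = φ (A ∩ T)
    full? : Decidable (λ A → A ∩ T ≡ T)
    full? A = A ∩ T ≟ₛ T
    full partial : List (Subset k)
    full = filter full? (sets 𝒜)
    partial = filter (¬? ∘ full?) (sets 𝒜)
    full-bound : φ T * suc ∣ W ∣ ≤ ∑ φ∩T full
    full-bound = begin
      φ T * suc ∣ W ∣          ≡⟨ cong (φ T *_) (sym length-fullMembers) ⟩
      φ T * length fullMembers ≤⟨ *-monoʳ-≤ (φ T) (length-sublist full fullMembers-unique
                                                     (uncurry (∈-filter⁺ full?) ∘ fullMembers-∈)) ⟩
      φ T * length full        ≡⟨ sym (∑-const (φ T) full) ⟩
      ∑ (λ _ → φ T) full       ≡⟨ ∑-cong full (λ A∈ → cong φ (sym (proj₂ (∈-filter⁻ full? {xs = sets 𝒜} A∈)))) ⟩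
      ∑ φ∩T full               ∎
    realised : ∀ {R} → R ∈ₗ properTraces → R ∈ₗ map (_∩ T) partial
    realised R∈ with ∈-filter⁻ (λ R → nonempty? R ×-dec ¬? (R ≟ₛ T)) R∈
    ... | R∈subsets , R-ne , R≢T with trace-realised (∈-subsetsOf⁻ T R∈subsets) R-ne
    ...   | A , A∈𝒜 , refl = ∈-map⁺ (_∩ T) (∈-filter⁺ (¬? ∘ full?) A∈𝒜 R≢T)
    partial-bound : ∑ φ properTraces ≤ ∑ φ∩T partial
    partial-bound = begin
      ∑ φ properTraces         ≤⟨ ∑-sublist φ (map (_∩ T) partial) properTraces-unique realised ⟩
      ∑ φ (map (_∩ T) partial) ≡⟨ ∑-map φ (_∩ T) partial ⟩
      ∑ φ∩T partial            ∎

  S : ℕ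
  S = ∑ (λ A → ∣ A ∩ T ∣) (sets 𝒜)

  G : ℕ
  G = ∑ (λ R → ∣ R ∣ ∸ 1) (subsetsOf T)

  N₀ : ℕ
  N₀ = length (filter (¬? ∘ nonempty?) (sets 𝒜))

  N₁ : ℕ
  N₁ = length (filter (λ A → ∣ A ∩ T ∣ ≟ 1) (sets 𝒜))

  S-upper : 2 * S + ∣ T ∣ ≤ ∣ T ∣ * size 𝒜
  S-upper = begin
    2 * S + ∣ T ∣
      ≡⟨ cong₂ (λ s t → 2 * s + t) S≡ (∣∣≡∑χ T) ⟩
    2 * ∑ (λ i → χ T i * frequency 𝒜 i) (allFin k) + ∑ (χ T) (allFin k)
      ≡⟨ cong (_+ ∑ (χ T) (allFin k)) (sym (∑-*ˡ 2 _ (allFin k))) ⟩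
    ∑ (λ i → 2 * (χ T i * frequency 𝒜 i)) (allFin k) + ∑ (χ T) (allFin k)
      ≡⟨ sym (∑-+ _ (χ T) (allFin k)) ⟩
    ∑ (λ i → 2 * (χ T i * frequency 𝒜 i) + χ T i) (allFin k)
      ≤⟨ ∑-mono (allFin k) (λ {i} _ → pointwise i) ⟩
    ∑ (λ i → size 𝒜 * χ T i) (allFin k)
      ≡⟨ trans (∑-*ˡ (size 𝒜) (χ T) (allFin k)) (trans (cong (size 𝒜 *_) (sym (∣∣≡∑χ T))) (*-comm (size 𝒜) ∣ T ∣)) ⟩
    ∣ T ∣ * size 𝒜 ∎
    where
    open ≤-Reasoning
    S≡ : S ≡ ∑ (λ i → χ T i * frequency 𝒜 i) (allFin k)
    S≡ = trans (double-counting T (sets 𝒜)) (∑-cong (allFin k) (λ {i} _ → cong (χ T i *_) (sym (frequency≡∑χ i))))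
    pointwise : ∀ i → 2 * (χ T i * frequency 𝒜 i) + χ T i ≤ size 𝒜 * χ T i
    pointwise i with i ∈? T
    ... | no  _   = z≤n
    ... | yes i∈T = begin
      2 * (1 * frequency 𝒜 i) + 1 ≡⟨ cong (λ f → 2 * f + 1) (*-identityˡ (frequency 𝒜 i)) ⟩
      2 * frequency 𝒜 i + 1       ≡⟨ +-comm (2 * frequency 𝒜 i) 1 ⟩
      suc (2 * frequency 𝒜 i)     ≤⟨ rare (T⊆U i∈T) ⟩
      size 𝒜                      ≡⟨ sym (*-identityʳ _) ⟩
      size 𝒜 * 1                  ∎

  N₀≤1 : N₀ ≤ 1
  N₀≤1 = length-sublist (∅ ∷ []) (Unique.filter⁺ _ (distinct 𝒜))
                        (λ A∈ → here (Empty-unique (proj₂ (∈-filter⁻ (¬? ∘ nonempty?) {xs = sets 𝒜} A∈))))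

  size≤#meeting+1 : size 𝒜 ≤ ∑ (λ A → 𝟙 (does (nonempty? (A ∩ T)))) (sets 𝒜) + 1
  size≤#meeting+1 = begin
    size 𝒜
      ≡⟨ trans (sym (∑1≡length (sets 𝒜))) (∑-filter-partition nonempty? (λ _ → 1) (sets 𝒜)) ⟩
    ∑ (λ _ → 1) (filter nonempty? (sets 𝒜)) + ∑ (λ _ → 1) (filter (¬? ∘ nonempty?) (sets 𝒜))
      ≡⟨ cong₂ _+_ (trans (∑1≡length (filter nonempty? (sets 𝒜))) (length-filter≡∑ nonempty? (sets 𝒜)))
                   (∑1≡length (filter (¬? ∘ nonempty?) (sets 𝒜))) ⟩
    ∑ (λ A → 𝟙 (does (nonempty? A))) (sets 𝒜) + N₀
      ≤⟨ +-mono-≤ (∑-mono (sets 𝒜) meets) N₀≤1 ⟩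
    ∑ (λ A → 𝟙 (does (nonempty? (A ∩ T)))) (sets 𝒜) + 1 ∎
    where
    open ≤-Reasoning
    meets : ∀ {A} → A ∈ₗ sets 𝒜 → 𝟙 (does (nonempty? A)) ≤ 𝟙 (does (nonempty? (A ∩ T)))
    meets {A} A∈𝒜 with nonempty? A
    ... | no  _  = z≤n
    ... | yes ne with nonempty? (A ∩ T)
    ...   | yes _      = ≤-refl
    ...   | no  ¬meets = ⊥-elim (¬meets (All.lookup T-transversal A∈𝒜 ne))

  G-upper : G ≤ ∑ (λ R → ∣ R ∣ ∸ 1) properTraces + (∣ T ∣ ∸ 1)
  G-upper = begin
    G                                            ≡⟨ ∑-filter-partition proper? g (subsetsOf T) ⟩
    ∑ g properTraces + ∑ g (filter (¬? ∘ proper?) (subsetsOf T)) ≤⟨ +-monoʳ-≤ (∑ g properTraces) improper-bound ⟩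
    ∑ g properTraces + (∣ T ∣ ∸ 1)               ∎
    where
    open ≤-Reasoning
    g : Subset k → ℕ
    g R = ∣ R ∣ ∸ 1
    proper? : Decidable (λ R → Nonempty R × R ≢ T)
    proper? R = nonempty? R ×-dec ¬? (R ≟ₛ T)
    improper : ∀ {R} → R ∈ₗ filter (¬? ∘ proper?) (subsetsOf T) → R ∈ₗ ∅ ∷ T ∷ []
    improper {R} R∈ with proj₂ (∈-filter⁻ (¬? ∘ proper?) {xs = subsetsOf T} R∈) | nonempty? R | R ≟ₛ T
    ... | _        | no empty | _        = here (Empty-unique empty)
    ... | _        | yes _    | yes R≡T  = there (here R≡T)
    ... | ¬proper  | yes ne   | no R≢T   = ⊥-elim (¬proper (ne , R≢T))
    improper-bound : ∑ g (filter (¬? ∘ proper?) (subsetsOf T)) ≤ ∣ T ∣ ∸ 1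
    improper-bound = begin
      ∑ g (filter (¬? ∘ proper?) (subsetsOf T))
        ≤⟨ ∑-sublist g (∅ ∷ T ∷ []) (Unique.filter⁺ _ (subsetsOf-unique T)) improper ⟩
      g ∅ + (g T + 0)                           ≡⟨ cong₂ (λ a b → a ∸ 1 + b) (∣⊥∣≡0 k) (+-identityʳ (g T)) ⟩
      ∣ T ∣ ∸ 1                                 ∎

  S-lower : size 𝒜 + (∣ T ∣ ∸ 1) * suc ∣ W ∣ + G ≤ S + 1 + (∣ T ∣ ∸ 1)
  S-lower = begin
    size 𝒜 + (∣ T ∣ ∸ 1) * suc ∣ W ∣ + G
      ≤⟨ +-mono-≤ (+-monoˡ-≤ _ size≤#meeting+1) G-upper ⟩
    #meeting + 1 + (∣ T ∣ ∸ 1) * suc ∣ W ∣ + (∑ g properTraces + (∣ T ∣ ∸ 1))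
      ≡⟨ regroup #meeting ((∣ T ∣ ∸ 1) * suc ∣ W ∣) (∑ g properTraces) (∣ T ∣ ∸ 1) ⟩
    #meeting + ((∣ T ∣ ∸ 1) * suc ∣ W ∣ + ∑ g properTraces) + 1 + (∣ T ∣ ∸ 1)
      ≤⟨ +-monoˡ-≤ _ (+-monoˡ-≤ 1 (+-monoʳ-≤ #meeting (∑-traces g))) ⟩
    #meeting + ∑ (λ A → ∣ A ∩ T ∣ ∸ 1) (sets 𝒜) + 1 + (∣ T ∣ ∸ 1)
      ≡⟨ cong (λ s → s + 1 + (∣ T ∣ ∸ 1)) (sym S-split) ⟩
    S + 1 + (∣ T ∣ ∸ 1) ∎
    where
    open ≤-Reasoning
    g : Subset k → ℕ
    g R = ∣ R ∣ ∸ 1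
    #meeting : ℕ
    #meeting = ∑ (λ A → 𝟙 (does (nonempty? (A ∩ T)))) (sets 𝒜)
    S-split : S ≡ #meeting + ∑ (λ A → ∣ A ∩ T ∣ ∸ 1) (sets 𝒜)
    S-split = trans (∑-cong (sets 𝒜) (λ {A} _ → ∣p∣≡𝟙+∣p∣∸1 (A ∩ T))) (∑-+ _ _ (sets 𝒜))
    regroup : ∀ a b c d → a + 1 + b + (c + d) ≡ a + (b + c) + 1 + d
    regroup = solve-∀

  S-lower′ : 2 * size 𝒜 + (∣ T ∣ ∸ 2) * suc ∣ W ∣ ≤ S + 2 * N₀ + N₁
  S-lower′ = begin
    2 * size 𝒜 + (∣ T ∣ ∸ 2) * suc ∣ W ∣
      ≤⟨ +-monoʳ-≤ (2 * size 𝒜) (≤-trans (m≤m+n _ _) (∑-traces (λ R → ∣ R ∣ ∸ 2))) ⟩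
    2 * size 𝒜 + ∑ (λ A → ∣ A ∩ T ∣ ∸ 2) (sets 𝒜)
      ≡⟨ cong (_+ ∑ (λ A → ∣ A ∩ T ∣ ∸ 2) (sets 𝒜)) (sym (∑-const 2 (sets 𝒜))) ⟩
    ∑ (λ _ → 2) (sets 𝒜) + ∑ (λ A → ∣ A ∩ T ∣ ∸ 2) (sets 𝒜)
      ≡⟨ sym (∑-+ (λ _ → 2) (λ A → ∣ A ∩ T ∣ ∸ 2) (sets 𝒜)) ⟩
    ∑ (λ A → 2 + (∣ A ∩ T ∣ ∸ 2)) (sets 𝒜)
      ≤⟨ ∑-mono (sets 𝒜) pointwise ⟩
    ∑ (λ A → ∣ A ∩ T ∣ + 2 * empty A + one A) (sets 𝒜)
      ≡⟨ trans (∑-+ _ one (sets 𝒜)) (cong₂ _+_ (trans (∑-+ _ _ (sets 𝒜)) (cong (S +_) (∑-*ˡ 2 empty (sets 𝒜)))) refl) ⟩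
    S + 2 * ∑ empty (sets 𝒜) + ∑ one (sets 𝒜)
      ≡⟨ sym (cong₂ (λ a b → S + 2 * a + b) (length-filter≡∑ (¬? ∘ nonempty?) (sets 𝒜))
                                             (length-filter≡∑ (λ A → ∣ A ∩ T ∣ ≟ 1) (sets 𝒜))) ⟩
    S + 2 * N₀ + N₁ ∎
    where
    open ≤-Reasoning
    empty one : Subset k → ℕ
    empty A = 𝟙 (does (¬? (nonempty? A)))
    one A = 𝟙 (does (∣ A ∩ T ∣ ≟ 1))
    disjoint⇒empty : ∀ {A} → A ∈ₗ sets 𝒜 → ∣ A ∩ T ∣ ≡ 0 → empty A ≡ 1
    disjoint⇒empty {A} A∈𝒜 ∣A∩T∣≡0 with nonempty? A
    ... | no  _  = refl
    ... | yes ne = let (_ , x∈A∩T) = All.lookup T-transversal A∈𝒜 ne in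
                   ⊥-elim (<⇒≢ (∈⇒1≤∣∣ x∈A∩T) (sym ∣A∩T∣≡0))
    pointwise : ∀ {A} → A ∈ₗ sets 𝒜 → 2 + (∣ A ∩ T ∣ ∸ 2) ≤ ∣ A ∩ T ∣ + 2 * empty A + one A
    pointwise {A} A∈𝒜 = 2+x∸2≤ ∣ A ∩ T ∣ (empty A) (disjoint⇒empty A∈𝒜)

  single-trace : ∀ {A t} → A ∈ₗ sets 𝒜 → A ∩ T ≡ ⁅ t ⁆ → t ∈ T × A ≡ ⁅ t ⁆ ∪ (A ─ T) × A ─ T ⊆ W × Nonempty (A ─ T)
  single-trace {A} {t} A∈𝒜 A∩T≡⁅t⁆ = t∈T , A≡⁅t⁆∪A─T , A─T⊆W , A─T≢∅
    where
    t∈T : t ∈ T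
    t∈T = proj₂ (x∈p∩q⁻ A T (subst (t ∈_) (sym A∩T≡⁅t⁆) (x∈⁅x⁆ t)))
    A≡⁅t⁆∪A─T : A ≡ ⁅ t ⁆ ∪ (A ─ T)
    A≡⁅t⁆∪A─T = trans (p≡p∩q∪p─q A T) (cong (_∪ (A ─ T)) A∩T≡⁅t⁆)
    A─T⊆W : A ─ T ⊆ W
    A─T⊆W x∈ = x∈p∧x∉q⇒x∈p─q (⊆-universe A∈𝒜 (p─q⊆p A T x∈)) (x∈p─q⇒x∉q A T x∈)
    A─T≢∅ : Nonempty (A ─ T)
    A─T≢∅ with nonempty? (A ─ T)
    ... | yes ne    = ne
    ... | no  empty = ⊥-elim (<⇒≱ (rare (T⊆U t∈T)) (singleton-frequent (subst (_∈ₗ sets 𝒜) A≡⁅t⁆ A∈𝒜)))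
      where
      A≡⁅t⁆ : A ≡ ⁅ t ⁆
      A≡⁅t⁆ = trans A≡⁅t⁆∪A─T (trans (cong (⁅ t ⁆ ∪_) (Empty-unique empty)) (∪-identityʳ ⁅ t ⁆))

  N₁-upper : N₁ + ∣ T ∣ ≤ ∣ T ∣ * 2 ^ ∣ W ∣
  N₁-upper = begin
    N₁ + ∣ T ∣                     ≤⟨ +-monoˡ-≤ ∣ T ∣ (length-sublist candidates (Unique.filter⁺ _ (distinct 𝒜)) candidate) ⟩
    length candidates + ∣ T ∣      ≡⟨ cong (_+ ∣ T ∣) length-candidates ⟩
    length W⁺ * ∣ T ∣ + ∣ T ∣      ≡⟨ +-comm (length W⁺ * ∣ T ∣) ∣ T ∣ ⟩
    suc (length W⁺) * ∣ T ∣        ≤⟨ *-monoˡ-≤ ∣ T ∣ W⁺-bound ⟩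
    2 ^ ∣ W ∣ * ∣ T ∣              ≡⟨ *-comm (2 ^ ∣ W ∣) ∣ T ∣ ⟩
    ∣ T ∣ * 2 ^ ∣ W ∣              ∎
    where
    open ≤-Reasoning
    W⁺ : List (Subset k)
    W⁺ = filter nonempty? (subsetsOf W)
    candidates : List (Subset k)
    candidates = concatMap (λ t → map (⁅ t ⁆ ∪_) W⁺) (elements T)
    length-candidates : length candidates ≡ length W⁺ * ∣ T ∣
    length-candidates = begin-equality
      length candidates                                  ≡⟨ length-concatMap (λ t → map (⁅ t ⁆ ∪_) W⁺) (elements T) ⟩
      ∑ (λ t → length (map (⁅ t ⁆ ∪_) W⁺)) (elements T) ≡⟨ ∑-cong (elements T) (λ {t} _ → length-map (⁅ t ⁆ ∪_) W⁺) ⟩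
      ∑ (λ _ → length W⁺) (elements T)                   ≡⟨ ∑-const (length W⁺) (elements T) ⟩
      length W⁺ * length (elements T)                    ≡⟨ cong (length W⁺ *_) (length-elements T) ⟩
      length W⁺ * ∣ T ∣                                  ∎
    W⁺-bound : suc (length W⁺) ≤ 2 ^ ∣ W ∣
    W⁺-bound = subst (suc (length W⁺) ≤_) (length-subsetsOf W)
      (length-sublist (subsetsOf W) (All.tabulate ∅∉W⁺ ∷ Unique.filter⁺ _ (subsetsOf-unique W)) W⁺⊆)
      where
      ∅∉W⁺ : ∀ {R} → R ∈ₗ W⁺ → ∅ ≢ R
      ∅∉W⁺ R∈ refl = let (_ , x∈∅) = proj₂ (∈-filter⁻ nonempty? {xs = subsetsOf W} R∈) in ∉⊥ x∈∅
      W⁺⊆ : ∀ {R} → R ∈ₗ ∅ ∷ W⁺ → R ∈ₗ subsetsOf W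
      W⁺⊆ (here refl) = ∈-subsetsOf⁺ W (⊥-elim ∘ ∉⊥)
      W⁺⊆ (there R∈)  = proj₁ (∈-filter⁻ nonempty? R∈)
    candidate : ∀ {A} → A ∈ₗ filter (λ A → ∣ A ∩ T ∣ ≟ 1) (sets 𝒜) → A ∈ₗ candidates
    candidate A∈ with ∈-filter⁻ (λ A → ∣ A ∩ T ∣ ≟ 1) {xs = sets 𝒜} A∈
    ... | A∈𝒜 , ∣A∩T∣≡1 with ∣p∣≡1⇒p≡⁅x⁆ _ ∣A∩T∣≡1
    ...   | t , A∩T≡⁅t⁆ with single-trace A∈𝒜 A∩T≡⁅t⁆
    ...     | t∈T , A≡⁅t⁆∪A─T , A─T⊆W , A─T≢∅ =
      ∈-concatMap⁺ (λ t → map (⁅ t ⁆ ∪_) W⁺) (lose (∈-elements⁺ t∈T)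
        (subst (_∈ₗ map (⁅ t ⁆ ∪_) W⁺) (sym A≡⁅t⁆∪A─T)
               (∈-map⁺ (⁅ t ⁆ ∪_) (∈-filter⁺ nonempty? (∈-subsetsOf⁺ W A─T⊆W) A─T≢∅))))

  3≤size : Nonempty U → 3 ≤ size 𝒜
  3≤size (x , x∈U) = ≤-trans (s≤s (*-monoʳ-≤ 2 1≤frequency)) (rare x∈U)
    where
    1≤frequency : 1 ≤ frequency 𝒜 x
    1≤frequency = subst (1 ≤_) (sym (frequency≡∑χ x))
                        (≤-trans (≤-reflexive (sym (χ-∈ x∈U))) (≤-∑ (λ A → χ A x) (universe-∈ ne)))

  countingBounds : CountingBounds (size 𝒜) ∣ U ∣ ∣ T ∣
  countingBounds = record
    { w = ∣ W ∣ ; S = S ; G = G ; N₀ = N₀ ; N₁ = N₁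
    ; w+k≡m = ∣W∣+∣T∣≡∣U∣
    ; S-upper = S-upper
    ; S-lower = S-lower
    ; G-eq = ∑-∣∣∸1-subsetsOf T
    ; S-lower′ = S-lower′
    ; N₀≤1 = N₀≤1
    ; N₁-upper = N₁-upper
    }

-- Arithmetic

≤-cast : ∀ {a b c d : ℕ} → a ≤ b → c ≡ a → b ≡ d → c ≤ d
≤-cast a≤b refl refl = a≤b

≤-of-+ : ∀ a b {c} → c ≡ a + b → a ≤ c
≤-of-+ a b c≡a+b = ≤-cast (m≤m+n a b) refl (sym c≡a+b)

*-monoʳ-<′ : ∀ c {x y} → 1 ≤ c → x < y → c * x < c * y
*-monoʳ-<′ (suc c) _ x<y = *-monoʳ-< (suc c) x<y

^-distribʳ-* : ∀ a b d → (a * b) ^ d ≡ a ^ d * b ^ d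
^-distribʳ-* a b zero    = refl
^-distribʳ-* a b (suc d) = trans (cong (a * b *_) (^-distribʳ-* a b d)) (interchange a b (a ^ d) (b ^ d))
  where
  interchange : ∀ a b x y → a * b * (x * y) ≡ a * x * (b * y)
  interchange = solve-∀

1≤^ : ∀ m d → 1 ≤ m → 1 ≤ m ^ d
1≤^ m zero    _   = s≤s z≤n
1≤^ m (suc d) 1≤m = *-mono-≤ 1≤m (1≤^ m d 1≤m)

2^-cancel-< : ∀ {x y} → 2 ^ x < 2 ^ y → x < y
2^-cancel-< {x} {y} 2^x<2^y with x <? y
... | yes x<y = x<y
... | no  x≮y = ⊥-elim (<⇒≱ 2^x<2^y (^-monoʳ-≤ 2 (≮⇒≥ x≮y)))

2^-cancel-≤ : ∀ {x y} → 2 ^ x ≤ 2 ^ y → x ≤ y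
2^-cancel-≤ {x} {y} 2^x≤2^y with x ≤? y
... | yes x≤y = x≤y
... | no  x≰y = ⊥-elim (<⇒≱ (^-monoʳ-< 2 (s≤s (s≤s z≤n)) (≰⇒> x≰y)) 2^x≤2^y)

2^-dominates : ∀ (f : ℕ → ℕ) c → f 0 ≤ 2 ^ c → (∀ i → f (suc i) ≤ 2 * f i) → ∀ i → f i ≤ 2 ^ (c + i)
2^-dominates f c base step zero    = subst (λ e → f 0 ≤ 2 ^ e) (sym (+-identityʳ c)) base
2^-dominates f c base step (suc i) =
  ≤-trans (step i) (≤-cast (*-monoʳ-≤ 2 (2^-dominates f c base step i)) refl (cong (2 ^_) (sym (+-suc c i))))

suc≤2^ : ∀ e → suc e ≤ 2 ^ e
suc≤2^ = 2^-dominates suc 0 ≤-refl (λ i → ≤-of-+ (2 + i) i (step i))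
  where
  step : ∀ i → 2 * suc i ≡ 2 + i + i
  step = solve-∀

2j+4≤2^[j+2] : ∀ j → 2 * j + 4 ≤ 2 ^ (2 + j)
2j+4≤2^[j+2] = 2^-dominates (λ j → 2 * j + 4) 2 ≤-refl (λ j → ≤-of-+ (2 * suc j + 4) (2 * j + 2) (step j))
  where
  step : ∀ j → 2 * (2 * j + 4) ≡ 2 * suc j + 4 + (2 * j + 2)
  step = solve-∀

2j+12≤2^[j+4] : ∀ j → 2 * j + 12 ≤ 2 ^ (4 + j)
2j+12≤2^[j+4] = 2^-dominates (λ j → 2 * j + 12) 4 (≤-of-+ 12 4 refl) (λ j → ≤-of-+ (2 * suc j + 12) (2 * j + 10) (step j))
  where
  step : ∀ j → 2 * (2 * j + 12) ≡ 2 * suc j + 12 + (2 * j + 10)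
  step = solve-∀

4h≤2^h : ∀ h → 4 ≤ h → 4 * h ≤ 2 ^ h
4h≤2^h h 4≤h = subst (λ x → 4 * x ≤ 2 ^ x) (m+[n∸m]≡n 4≤h)
  (2^-dominates (λ i → 4 * (4 + i)) 4 ≤-refl (λ i → ≤-of-+ (4 * (4 + suc i)) (4 * i + 12) (step i)) (h ∸ 4))
  where
  step : ∀ i → 2 * (4 * (4 + i)) ≡ 4 * (4 + suc i) + (4 * i + 12)
  step = solve-∀

[b+1][2b+7]<2^b : ∀ b → 8 ≤ b → suc b * (2 * b + 7) < 2 ^ b
[b+1][2b+7]<2^b b 8≤b = subst (λ x → suc x * (2 * x + 7) < 2 ^ x) (m+[n∸m]≡n 8≤b)
  (2^-dominates (λ i → suc ((9 + i) * (2 * (8 + i) + 7))) 8 (≤-of-+ 208 48 refl)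
    (λ i → ≤-of-+ (suc ((10 + i) * (2 * (9 + i) + 7))) (2 * i * i + 37 * i + 165) (step i)) (b ∸ 8))
  where
  step : ∀ i → 2 * suc ((9 + i) * (2 * (8 + i) + 7)) ≡ suc ((10 + i) * (2 * (9 + i) + 7)) + (2 * i * i + 37 * i + 165)
  step = solve-∀

module _ {n m k : ℕ} (3≤n : 3 ≤ n) (bounds : CountingBounds n m k) where
  open CountingBounds bounds

  private
    2≤k : 2 ≤ k
    2≤k with k ≤? 1
    ... | no  k≰1 = ≰⇒> k≰1
    ... | yes k≤1 = ⊥-elim (<⇒≱ 3≤n (≤-trans n≤S+1 (+-monoˡ-≤ 1 S≤1)))
      where
      k∸1≡0 : k ∸ 1 ≡ 0
      k∸1≡0 = m≤n⇒m∸n≡0 k≤1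
      n≤S+1 : n ≤ S + 1
      n≤S+1 = begin
        n                                ≤⟨ ≤-trans (m≤m+n n _) (m≤m+n _ G) ⟩
        n + (k ∸ 1) * suc w + G          ≤⟨ S-lower ⟩
        S + 1 + (k ∸ 1)                  ≡⟨ trans (cong (S + 1 +_) k∸1≡0) (+-identityʳ _) ⟩
        S + 1                            ∎
        where open ≤-Reasoning
      2S≤n : 2 * S ≤ n
      2S≤n = begin
        2 * S      ≤⟨ m≤m+n (2 * S) k ⟩
        2 * S + k  ≤⟨ S-upper ⟩
        k * n      ≤⟨ *-monoˡ-≤ n k≤1 ⟩
        1 * n      ≡⟨ *-identityˡ n ⟩
        n          ∎
        where open ≤-Reasoning
      S≤1 : S ≤ 1
      S≤1 = +-cancelˡ-≤ S S 1 (≤-cast (≤-trans 2S≤n n≤S+1) (cong (S +_) (sym (+-identityʳ S))) refl)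

  3≤k : 3 ≤ k
  3≤k with m≤n⇒m<n∨m≡n 2≤k
  ... | inj₁ 2<k  = 2<k
  ... | inj₂ refl = ⊥-elim (<-irrefl refl (≤-trans chain (+-monoˡ-≤ 1 S+1≤n)))
    where
    G≡1 : G ≡ 1
    G≡1 = *-cancelˡ-≡ G 1 2 (+-cancelʳ-≡ 8 (2 * G) 2 G-eq)
    S+1≤n : S + 1 ≤ n
    S+1≤n = *-cancelˡ-≤ 2 (≤-cast S-upper (double S) refl)
      where
      double : ∀ S → 2 * (S + 1) ≡ 2 * S + 2
      double = solve-∀
    chain : suc (n + 1) ≤ S + 1 + 1
    chain = ≤-trans (≤-cast (+-monoʳ-≤ n (+-mono-≤ (s≤s (z≤n {w + 0})) (≤-reflexive (sym G≡1))))
                            (regroup n) (sym (+-assoc n (1 * suc w) G)))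
                    S-lower
      where
      regroup : ∀ n → suc (n + 1) ≡ n + (1 + 1)
      regroup = solve-∀

key-inequality : ∀ j n w S G →
  2 * S + (2 + j) ≤ (2 + j) * n →
  n + suc j * suc w + G ≤ S + 1 + suc j →
  2 * G + 2 ^ (3 + j) ≡ (2 + j) * 2 ^ (2 + j) + 2 →
  2 * suc j * suc w + j * 2 ^ (2 + j) ≤ j * n + j
key-inequality j n w S G upper lower G-eq = +-cancelʳ-≤ X _ _ (begin
  2 * suc j * suc w + j * P + X                  ≡⟨ regroup j w P S n ⟩
  (j * P + 2) + R                                ≡⟨ cong (_+ R) (sym 2G≡) ⟩
  2 * G + R                                      ≡⟨ regroup′ n j w G S ⟩
  2 * (n + suc j * suc w + G) + (2 * S + (2 + j)) ≤⟨ +-mono-≤ (*-monoʳ-≤ 2 lower) upper ⟩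
  2 * (S + 1 + suc j) + (2 + j) * n              ≡⟨ regroup″ S j n ⟩
  j * n + j + X                                  ∎)
  where
  open ≤-Reasoning
  P X R : ℕ
  P = 2 ^ (2 + j)
  X = 2 * S + 2 * n + j + 4
  R = 2 * suc j * suc w + 2 * S + 2 * n + j + 2
  2G≡ : 2 * G ≡ j * P + 2
  2G≡ = +-cancelʳ-≡ (2 * P) (2 * G) (j * P + 2) (trans G-eq (expand j P))
    where
    expand : ∀ j P → (2 + j) * P + 2 ≡ j * P + 2 + 2 * P
    expand = solve-∀
  regroup : ∀ j w P S n →
    2 * suc j * suc w + j * P + (2 * S + 2 * n + j + 4) ≡ j * P + 2 + (2 * suc j * suc w + 2 * S + 2 * n + j + 2)
  regroup = solve-∀
  regroup′ : ∀ n j w G S →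
    2 * G + (2 * suc j * suc w + 2 * S + 2 * n + j + 2) ≡ 2 * (n + suc j * suc w + G) + (2 * S + (2 + j))
  regroup′ = solve-∀
  regroup″ : ∀ S j n → 2 * (S + 1 + suc j) + (2 + j) * n ≡ j * n + j + (2 * S + 2 * n + j + 4)
  regroup″ = solve-∀

key⇒2m<n : ∀ j n w → 1 ≤ j → 2 * suc j * suc w + j * 2 ^ (2 + j) ≤ j * n + j → 2 * (w + (2 + j)) < n
key⇒2m<n j n w 1≤j key with n ≤? 2 * (w + (2 + j))
... | no  n≰2m = ≰⇒> n≰2m
... | yes n≤2m = ⊥-elim (<-irrefl refl (begin-strict
  R                                   <⟨ m<m+n R (≤-trans 1≤j (m≤n+m j (2 * w + 2))) ⟩
  R + (2 * w + 2 + j)                 ≡⟨ sym (regroup j w) ⟩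
  2 * suc j * suc w + j * (2 * j + 4) ≤⟨ +-monoʳ-≤ (2 * suc j * suc w) (*-monoʳ-≤ j (2j+4≤2^[j+2] j)) ⟩
  2 * suc j * suc w + j * 2 ^ (2 + j) ≤⟨ key ⟩
  j * n + j                           ≤⟨ +-monoˡ-≤ j (*-monoʳ-≤ j n≤2m) ⟩
  R                                   ∎))
  where
  open ≤-Reasoning
  R : ℕ
  R = j * (2 * (w + (2 + j))) + j
  regroup : ∀ j w → 2 * suc j * suc w + j * (2 * j + 4) ≡ j * (2 * (w + (2 + j))) + j + (2 * w + 2 + j)
  regroup = solve-∀

-- What key-inequality leaves for a transversal of size j + 2 and excess d = n − 2m.
Feasible : ℕ → ℕ → ℕ → Set
Feasible m d j = 2 * m + j * 2 ^ (2 + j) ≤ 2 * j * j + 5 * j + 2 + j * d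

key⇒feasible : ∀ j w d → 2 * suc j * suc w + j * 2 ^ (2 + j) ≤ j * (2 * (w + (2 + j)) + d) + j →
               Feasible (w + (2 + j)) d j
key⇒feasible j w d key = +-cancelʳ-≤ (2 * j * w) _ _ (≤-cast (+-monoˡ-≤ 2 key) (lhs j w (2 ^ (2 + j))) (rhs j w d))
  where
  lhs : ∀ j w P → 2 * (w + (2 + j)) + j * P + 2 * j * w ≡ 2 * suc j * suc w + j * P + 2
  lhs = solve-∀
  rhs : ∀ j w d → j * (2 * (w + (2 + j)) + d) + j + 2 ≡ 2 * j * j + 5 * j + 2 + j * d + 2 * j * w
  rhs = solve-∀

excess⇒4w+11≤n : ∀ {n m} w → w + 3 ≡ m → 2 * m < n → Feasible m (n ∸ 2 * m) 1 → 4 * w + 11 ≤ n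
excess⇒4w+11≤n {n} {m} w w+3≡m 2m<n feasible = +-cancelʳ-≤ 9 _ _ (begin
  4 * w + 11 + 9                     ≡⟨ regroup w ⟩
  2 * (w + 3) + (2 * (w + 3) + 8)    ≡⟨ cong (λ m → 2 * m + (2 * m + 8)) w+3≡m ⟩
  2 * m + (2 * m + 8)                ≤⟨ +-monoʳ-≤ (2 * m) (≤-cast feasible refl (regroup′ (n ∸ 2 * m))) ⟩
  2 * m + (9 + (n ∸ 2 * m))          ≡⟨ regroup″ (2 * m) (n ∸ 2 * m) ⟩
  2 * m + (n ∸ 2 * m) + 9            ≡⟨ cong (_+ 9) (m+[n∸m]≡n (<⇒≤ 2m<n)) ⟩
  n + 9                              ∎)
  where
  open ≤-Reasoning
  regroup : ∀ w → 4 * w + 11 + 9 ≡ 2 * (w + 3) + (2 * (w + 3) + 8)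
  regroup = solve-∀
  regroup′ : ∀ d → 2 * 1 * 1 + 5 * 1 + 2 + 1 * d ≡ 9 + d
  regroup′ = solve-∀
  regroup″ : ∀ x d → x + (9 + d) ≡ x + d + 9
  regroup″ = solve-∀

three-element-transversal : ∀ {n m} → CountingBounds n m 3 → m ≤ 5 → 2 * m < n × Feasible m (n ∸ 2 * m) 1 → ⊥
three-element-transversal {n} bounds m≤5 (2m<n , feasible) =
  small w w≤2 (≤-trans (+-monoˡ-≤ (2 * w + 7) (excess⇒4w+11≤n w w+k≡m 2m<n feasible)) n+2w+7≤6·2^w)
  where
  open CountingBounds bounds
  w≤2 : w ≤ 2
  w≤2 = ≤-pred (≤-pred (≤-pred (≤-cast m≤5 (trans (+-comm 3 w) w+k≡m) refl)))
  n+2w+1≤2N₁ : n + 2 * w + 1 ≤ 2 * N₁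
  n+2w+1≤2N₁ = +-cancelʳ-≤ (3 * n + 2 * S + 4) _ _ (≤-cast combined (lhs n w S) (rhs S N₁ n))
    where
    combined : 2 * (2 * n + 1 * suc w) + (2 * S + 3) ≤ 2 * (S + 2 * 1 + N₁) + 3 * n
    combined = +-mono-≤ (*-monoʳ-≤ 2 (≤-trans S-lower′ (+-monoˡ-≤ N₁ (+-monoʳ-≤ S (*-monoʳ-≤ 2 N₀≤1))))) S-upper
    lhs : ∀ n w S → n + 2 * w + 1 + (3 * n + 2 * S + 4) ≡ 2 * (2 * n + 1 * suc w) + (2 * S + 3)
    lhs = solve-∀
    rhs : ∀ S N₁ n → 2 * (S + 2 * 1 + N₁) + 3 * n ≡ 2 * N₁ + (3 * n + 2 * S + 4)
    rhs = solve-∀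
  n+2w+7≤6·2^w : n + (2 * w + 7) ≤ 6 * 2 ^ w
  n+2w+7≤6·2^w = +-cancelʳ-≤ (2 * N₁) _ _ (≤-cast (+-mono-≤ n+2w+1≤2N₁ (*-monoʳ-≤ 2 N₁-upper)) (lhs n w N₁) (rhs N₁ (2 ^ w)))
    where
    lhs : ∀ n w N₁ → n + (2 * w + 7) + 2 * N₁ ≡ n + 2 * w + 1 + 2 * (N₁ + 3)
    lhs = solve-∀
    rhs : ∀ N₁ p → 2 * N₁ + 2 * (3 * p) ≡ 6 * p + 2 * N₁
    rhs = solve-∀
  small : ∀ w → w ≤ 2 → ¬ (4 * w + 11 + (2 * w + 7) ≤ 6 * 2 ^ w)
  small 0 _ = ≤⇒≤ᵇ
  small 1 _ = ≤⇒≤ᵇ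
  small 2 _ = ≤⇒≤ᵇ
  small (suc (suc (suc _))) (s≤s (s≤s ()))

-- The second alternative of SizeBound n m, with d = n − 2m.
LogBound : ℕ → ℕ → Set
LogBound m d = ∀ p s → 1 ≤ s → p ^ d * 2 ^ (2 * m) < m ^ d * s ^ d → 2 ^ p ≤ m ^ s

module _ {m d : ℕ} (logBound : LogBound m d) (1≤m : 1 ≤ m) where

  -- LogBound at p / s = m α / β: once α / β exceeds log₂ m / m, (β / α)^d is at most 4^m.
  ratio-bound : ∀ α β → 1 ≤ β → m ^ β < 2 ^ (m * α) → β ^ d ≤ α ^ d * 2 ^ (2 * m)
  ratio-bound α β 1≤β m^β<2^mα with α ^ d * 2 ^ (2 * m) <? β ^ d
  ... | no  ≮ = ≮⇒≥ ≮
  ... | yes ratio>4^m = ⊥-elim (<⇒≱ m^β<2^mα (logBound (m * α) β 1≤β scaled))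
    where
    scaled : (m * α) ^ d * 2 ^ (2 * m) < m ^ d * β ^ d
    scaled = subst (_< m ^ d * β ^ d)
      (trans (sym (*-assoc (m ^ d) (α ^ d) _)) (cong (_* 2 ^ (2 * m)) (sym (^-distribʳ-* m α d))))
      (*-monoʳ-<′ (m ^ d) (1≤^ m d 1≤m) ratio>4^m)

  excess-bound : ∀ α β D → 1 ≤ α → α ≤ β → m ^ β < 2 ^ (m * α) → α ^ suc D * 2 ^ (2 * m) < β ^ suc D → d ≤ D
  excess-bound α β D 1≤α α≤β m^β<2^mα α^D+1<β^D+1 with d ≤? D
  ... | yes d≤D = d≤D
  ... | no  d≰D = ⊥-elim (<⇒≱ (subst (λ e → α ^ e * 2 ^ (2 * m) < β ^ e) (m+[n∸m]≡n (≰⇒> d≰D)) (grow (d ∸ suc D)))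
                               (ratio-bound α β (≤-trans 1≤α α≤β) m^β<2^mα))
    where
    grow : ∀ i → α ^ (suc D + i) * 2 ^ (2 * m) < β ^ (suc D + i)
    grow zero    = subst (λ e → α ^ e * 2 ^ (2 * m) < β ^ e) (sym (+-identityʳ (suc D))) α^D+1<β^D+1
    grow (suc i) = subst (λ e → α ^ e * 2 ^ (2 * m) < β ^ e) (sym (+-suc (suc D) i))
      (≤-trans (≤-cast (*-monoʳ-<′ α 1≤α (grow i)) (cong suc (*-assoc α _ _)) refl) (*-monoˡ-≤ (β ^ (suc D + i)) α≤β))

-- Small m

feasible-mono : ∀ m j {d D} → d ≤ D → Feasible m d j → Feasible m D j
feasible-mono m j d≤D feasible = ≤-trans feasible (+-monoʳ-≤ _ (*-monoʳ-≤ j d≤D))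

infeasible-6≤j : ∀ m d i → d ≤ 237 → ¬ Feasible m d (6 + i)
infeasible-6≤j m d i d≤237 feasible = <-irrefl refl (≤-trans chain feasible)
  where
  open ≤-Reasoning
  j : ℕ
  j = 6 + i
  bound : 2 * j + 7 + d ≤ 2 ^ (8 + i)
  bound = 2^-dominates (λ i → 2 * (6 + i) + 7 + d) 8 (+-monoʳ-≤ 19 d≤237)
            (λ i → ≤-of-+ (2 * (6 + suc i) + 7 + d) (2 * i + 17 + d) (step i d)) i
    where
    step : ∀ i d → 2 * (2 * (6 + i) + 7 + d) ≡ 2 * (6 + suc i) + 7 + d + (2 * i + 17 + d)
    step = solve-∀
  chain : suc (2 * j * j + 5 * j + 2 + j * d) ≤ 2 * m + j * 2 ^ (2 + j)
  chain = begin
    suc (2 * j * j + 5 * j + 2 + j * d) ≤⟨ ≤-of-+ _ (2 * i + 9) (regroup i d) ⟩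
    j * (2 * j + 7 + d)                  ≤⟨ *-monoʳ-≤ j bound ⟩
    j * 2 ^ (2 + j)                      ≤⟨ m≤n+m _ (2 * m) ⟩
    2 * m + j * 2 ^ (2 + j)              ∎
    where
    regroup : ∀ i d →
      (6 + i) * (2 * (6 + i) + 7 + d) ≡ suc (2 * (6 + i) * (6 + i) + 5 * (6 + i) + 2 + (6 + i) * d) + (2 * i + 9)
    regroup = solve-∀

Excluded : ℕ → ℕ → ℕ → Set
Excluded m D j = j + 2 ≤ m → ¬ (j ≡ 1 × m ≤ 5) → ¬ Feasible m D j

excluded? : ∀ m D j → Dec (Excluded m D j)
excluded? m D j =
  j + 2 ≤? m →-dec ¬? (j ≟ 1 ×-dec m ≤? 5) →-dec ¬? (2 * m + j * 2 ^ (2 + j) ≤? 2 * j * j + 5 * j + 2 + j * D)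

Certified : ℕ → ℕ × ℕ × ℕ → Set
Certified m (α , β , D) =
  m ^ β < 2 ^ (m * α) × 1 ≤ α × α ≤ β × α ^ suc D * 2 ^ (2 * m) < β ^ suc D × D ≤ 237 ×
  Excluded m D 1 × Excluded m D 2 × Excluded m D 3 × Excluded m D 4 × Excluded m D 5

certified? : ∀ m c → Dec (Certified m c)
certified? m (α , β , D) =
  m ^ β <? 2 ^ (m * α) ×-dec 1 ≤? α ×-dec α ≤? β ×-dec α ^ suc D * 2 ^ (2 * m) <? β ^ suc D ×-dec D ≤? 237 ×-dec
  excluded? m D 1 ×-dec excluded? m D 2 ×-dec excluded? m D 3 ×-dec excluded? m D 4 ×-dec excluded? m D 5

certified-infeasible : ∀ {m d} c → Certified m c → 1 ≤ m → LogBound m d →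
                       ∀ j → 1 ≤ j → j + 2 ≤ m → ¬ (j ≡ 1 × m ≤ 5) → ¬ Feasible m d j
certified-infeasible {m} {d} (α , β , D) (log , 1≤α , α≤β , excess , D≤237 , ex₁ , ex₂ , ex₃ , ex₄ , ex₅) 1≤m logBound =
  infeasible
  where
  d≤D : d ≤ D
  d≤D = excess-bound logBound 1≤m α β D 1≤α α≤β log excess
  infeasible : ∀ j → 1 ≤ j → j + 2 ≤ m → ¬ (j ≡ 1 × m ≤ 5) → ¬ Feasible m d j
  infeasible 1 _ j+2≤m ¬small = ex₁ j+2≤m ¬small ∘ feasible-mono m 1 d≤D
  infeasible 2 _ j+2≤m ¬small = ex₂ j+2≤m ¬small ∘ feasible-mono m 2 d≤D
  infeasible 3 _ j+2≤m ¬small = ex₃ j+2≤m ¬small ∘ feasible-mono m 3 d≤D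
  infeasible 4 _ j+2≤m ¬small = ex₄ j+2≤m ¬small ∘ feasible-mono m 4 d≤D
  infeasible 5 _ j+2≤m ¬small = ex₅ j+2≤m ¬small ∘ feasible-mono m 5 d≤D
  infeasible (suc (suc (suc (suc (suc (suc i)))))) _ _ _ = infeasible-6≤j m d i (≤-trans d≤D D≤237)

-- Entry i is the certificate (α , β , D) for m = i + 3.
certificates : Vec (ℕ × ℕ × ℕ) 253
certificates =
  (2 , 3 , 10) ∷ (4 , 7 , 9) ∷ (1 , 2 , 10) ∷ (4 , 9 , 10) ∷ (3 , 7 , 11) ∷ (2 , 5 , 12) ∷
  (2 , 5 , 13) ∷ (1 , 3 , 12) ∷ (1 , 3 , 13) ∷ (1 , 3 , 15) ∷ (1 , 3 , 16) ∷ (1 , 3 , 17) ∷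
  (1 , 3 , 18) ∷ (1 , 3 , 20) ∷ (1 , 4 , 17) ∷ (1 , 4 , 18) ∷ (1 , 4 , 19) ∷ (1 , 4 , 20) ∷
  (1 , 4 , 21) ∷ (1 , 4 , 22) ∷ (1 , 5 , 19) ∷ (1 , 5 , 20) ∷ (1 , 5 , 21) ∷ (1 , 5 , 22) ∷
  (1 , 5 , 23) ∷ (1 , 5 , 24) ∷ (1 , 5 , 24) ∷ (1 , 6 , 23) ∷ (1 , 6 , 23) ∷ (1 , 6 , 24) ∷
  (1 , 6 , 25) ∷ (1 , 6 , 26) ∷ (1 , 6 , 27) ∷ (1 , 6 , 27) ∷ (1 , 7 , 26) ∷ (1 , 7 , 27) ∷
  (1 , 7 , 27) ∷ (1 , 7 , 28) ∷ (1 , 7 , 29) ∷ (1 , 7 , 29) ∷ (1 , 7 , 30) ∷ (1 , 8 , 29) ∷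
  (1 , 8 , 30) ∷ (1 , 8 , 30) ∷ (1 , 8 , 31) ∷ (1 , 8 , 32) ∷ (1 , 8 , 32) ∷ (1 , 8 , 33) ∷
  (1 , 8 , 34) ∷ (1 , 9 , 32) ∷ (1 , 9 , 33) ∷ (1 , 9 , 34) ∷ (1 , 9 , 34) ∷ (1 , 9 , 35) ∷
  (1 , 9 , 35) ∷ (1 , 9 , 36) ∷ (1 , 10 , 35) ∷ (1 , 10 , 36) ∷ (1 , 10 , 36) ∷ (1 , 10 , 37) ∷
  (1 , 10 , 37) ∷ (1 , 10 , 38) ∷ (1 , 10 , 39) ∷ (1 , 10 , 39) ∷ (1 , 11 , 38) ∷ (1 , 11 , 39) ∷
  (1 , 11 , 39) ∷ (1 , 11 , 40) ∷ (1 , 11 , 41) ∷ (1 , 11 , 41) ∷ (1 , 11 , 42) ∷ (1 , 11 , 42) ∷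
  (1 , 12 , 41) ∷ (1 , 12 , 42) ∷ (1 , 12 , 42) ∷ (1 , 12 , 43) ∷ (1 , 12 , 44) ∷ (1 , 12 , 44) ∷
  (1 , 12 , 45) ∷ (1 , 12 , 45) ∷ (1 , 13 , 44) ∷ (1 , 13 , 45) ∷ (1 , 13 , 45) ∷ (1 , 13 , 46) ∷
  (1 , 13 , 47) ∷ (1 , 13 , 47) ∷ (1 , 13 , 48) ∷ (1 , 13 , 48) ∷ (1 , 13 , 49) ∷ (1 , 14 , 48) ∷
  (1 , 14 , 48) ∷ (1 , 14 , 49) ∷ (1 , 14 , 49) ∷ (1 , 14 , 50) ∷ (1 , 14 , 50) ∷ (1 , 14 , 51) ∷
  (1 , 14 , 52) ∷ (1 , 15 , 51) ∷ (1 , 15 , 51) ∷ (1 , 15 , 52) ∷ (1 , 15 , 52) ∷ (1 , 15 , 53) ∷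
  (1 , 15 , 53) ∷ (1 , 15 , 54) ∷ (1 , 15 , 54) ∷ (1 , 15 , 55) ∷ (1 , 16 , 54) ∷ (1 , 16 , 55) ∷
  (1 , 16 , 55) ∷ (1 , 16 , 56) ∷ (1 , 16 , 56) ∷ (1 , 16 , 57) ∷ (1 , 16 , 57) ∷ (1 , 16 , 58) ∷
  (1 , 17 , 57) ∷ (1 , 17 , 57) ∷ (1 , 17 , 58) ∷ (1 , 17 , 58) ∷ (1 , 17 , 59) ∷ (1 , 17 , 59) ∷
  (1 , 17 , 60) ∷ (1 , 17 , 60) ∷ (1 , 17 , 61) ∷ (1 , 18 , 60) ∷ (1 , 18 , 60) ∷ (1 , 18 , 61) ∷
  (1 , 18 , 61) ∷ (1 , 18 , 62) ∷ (1 , 18 , 62) ∷ (1 , 18 , 63) ∷ (1 , 18 , 63) ∷ (1 , 18 , 64) ∷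
  (1 , 19 , 63) ∷ (1 , 19 , 64) ∷ (1 , 19 , 64) ∷ (1 , 19 , 64) ∷ (1 , 19 , 65) ∷ (1 , 19 , 65) ∷
  (1 , 19 , 66) ∷ (1 , 19 , 66) ∷ (1 , 19 , 67) ∷ (1 , 20 , 66) ∷ (1 , 20 , 67) ∷ (1 , 20 , 67) ∷
  (1 , 20 , 68) ∷ (1 , 20 , 68) ∷ (1 , 20 , 68) ∷ (1 , 20 , 69) ∷ (1 , 20 , 69) ∷ (1 , 20 , 70) ∷
  (1 , 21 , 69) ∷ (1 , 21 , 70) ∷ (1 , 21 , 70) ∷ (1 , 21 , 71) ∷ (1 , 21 , 71) ∷ (1 , 21 , 71) ∷
  (1 , 21 , 72) ∷ (1 , 21 , 72) ∷ (1 , 21 , 73) ∷ (1 , 22 , 72) ∷ (1 , 22 , 73) ∷ (1 , 22 , 73) ∷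
  (1 , 22 , 74) ∷ (1 , 22 , 74) ∷ (1 , 22 , 74) ∷ (1 , 22 , 75) ∷ (1 , 22 , 75) ∷ (1 , 22 , 76) ∷
  (1 , 23 , 75) ∷ (1 , 23 , 76) ∷ (1 , 23 , 76) ∷ (1 , 23 , 76) ∷ (1 , 23 , 77) ∷ (1 , 23 , 77) ∷
  (1 , 23 , 78) ∷ (1 , 23 , 78) ∷ (1 , 23 , 79) ∷ (1 , 24 , 78) ∷ (1 , 24 , 78) ∷ (1 , 24 , 79) ∷
  (1 , 24 , 79) ∷ (1 , 24 , 80) ∷ (1 , 24 , 80) ∷ (1 , 24 , 81) ∷ (1 , 24 , 81) ∷ (1 , 24 , 82) ∷
  (1 , 24 , 82) ∷ (1 , 25 , 81) ∷ (1 , 25 , 82) ∷ (1 , 25 , 82) ∷ (1 , 25 , 83) ∷ (1 , 25 , 83) ∷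
  (1 , 25 , 83) ∷ (1 , 25 , 84) ∷ (1 , 25 , 84) ∷ (1 , 25 , 85) ∷ (1 , 26 , 84) ∷ (1 , 26 , 85) ∷
  (1 , 26 , 85) ∷ (1 , 26 , 85) ∷ (1 , 26 , 86) ∷ (1 , 26 , 86) ∷ (1 , 26 , 87) ∷ (1 , 26 , 87) ∷
  (1 , 26 , 88) ∷ (1 , 27 , 87) ∷ (1 , 27 , 87) ∷ (1 , 27 , 88) ∷ (1 , 27 , 88) ∷ (1 , 27 , 89) ∷
  (1 , 27 , 89) ∷ (1 , 27 , 90) ∷ (1 , 27 , 90) ∷ (1 , 27 , 90) ∷ (1 , 27 , 91) ∷ (1 , 28 , 90) ∷
  (1 , 28 , 91) ∷ (1 , 28 , 91) ∷ (1 , 28 , 91) ∷ (1 , 28 , 92) ∷ (1 , 28 , 92) ∷ (1 , 28 , 93) ∷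
  (1 , 28 , 93) ∷ (1 , 28 , 94) ∷ (1 , 29 , 93) ∷ (1 , 29 , 93) ∷ (1 , 29 , 94) ∷ (1 , 29 , 94) ∷
  (1 , 29 , 95) ∷ (1 , 29 , 95) ∷ (1 , 29 , 95) ∷ (1 , 29 , 96) ∷ (1 , 29 , 96) ∷ (1 , 29 , 97) ∷
  (1 , 30 , 96) ∷ (1 , 30 , 97) ∷ (1 , 30 , 97) ∷ (1 , 30 , 97) ∷ (1 , 30 , 98) ∷ (1 , 30 , 98) ∷
  (1 , 30 , 99) ∷ (1 , 30 , 99) ∷ (1 , 30 , 99) ∷ (1 , 30 , 100) ∷ (1 , 31 , 99) ∷ (1 , 31 , 100) ∷
  (1 , 31 , 100) ∷ (1 , 31 , 100) ∷ (1 , 31 , 101) ∷ (1 , 31 , 101) ∷ (1 , 31 , 102) ∷ (1 , 31 , 102) ∷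
  (1 , 31 , 102) ∷ []

all-certified : ∀ (i : Fin 253) → Certified (toℕ i + 3) (lookup certificates i)
all-certified = toWitness {a? = all? (λ i → certified? (toℕ i + 3) (lookup certificates i))} tt

infeasible-small : ∀ {m d} → 3 ≤ m → m ≤ 255 → LogBound m d →
                   ∀ j → 1 ≤ j → j + 2 ≤ m → ¬ (j ≡ 1 × m ≤ 5) → ¬ Feasible m d j
infeasible-small {m} {d} 3≤m m≤255 =
  subst (λ m → LogBound m d → ∀ j → 1 ≤ j → j + 2 ≤ m → ¬ (j ≡ 1 × m ≤ 5) → ¬ Feasible m d j) m≡
  (certified-infeasible (lookup certificates i) (all-certified i) (≤-trans (s≤s z≤n) (m≤n+m 3 (toℕ i))))
  where
  i : Fin 253
  i = fromℕ< (s≤s (∸-monoˡ-≤ 3 m≤255))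
  m≡ : toℕ i + 3 ≡ m
  m≡ = trans (cong (_+ 3) (toℕ-fromℕ< _)) (m∸n+n≡m 3≤m)

-- Large m

parity : ∀ x → ∃[ h ] (x ≡ h + h ⊎ x ≡ suc (h + h))
parity zero    = 0 , inj₁ refl
parity (suc x) with parity x
... | h , inj₁ x≡h+h     = h , inj₂ (cong suc x≡h+h)
... | h , inj₂ x≡1+h+h   = suc h , inj₁ (cong suc (trans x≡1+h+h (sym (+-suc h h))))

halving : ∀ x → 8 ≤ x → ∃[ h ] (4 ≤ h × x ≤ suc (h + h) × 2 * (x * 2 ^ h) ≤ 2 ^ x)
halving x 8≤x with parity x
... | h , inj₁ refl = h , 4≤h (≤-trans 8≤x (n≤1+n _)) , n≤1+n _ , even
  where
  4≤h : 8 ≤ suc (h + h) → 4 ≤ h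
  4≤h 8≤2h+1 with 4 ≤? h
  ... | yes 4≤h = 4≤h
  ... | no  4≰h = let h≤3 = ≤-pred (≰⇒> 4≰h) in ⊥-elim (<⇒≱ (s≤s (s≤s (+-mono-≤ h≤3 h≤3))) 8≤2h+1)
  even : 2 * ((h + h) * 2 ^ h) ≤ 2 ^ (h + h)
  even = ≤-cast (*-monoˡ-≤ (2 ^ h) (4h≤2^h h (4≤h (≤-trans 8≤x (n≤1+n _))))) (regroup h (2 ^ h)) (sym (^-distribˡ-+-* 2 h h))
    where
    regroup : ∀ h X → 2 * ((h + h) * X) ≡ 4 * h * X
    regroup = solve-∀
... | h , inj₂ refl = h , 4≤h , ≤-refl , odd
  where
  4≤h : 4 ≤ h
  4≤h with 4 ≤? h
  ... | yes 4≤h = 4≤h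
  ... | no  4≰h = let h≤3 = ≤-pred (≰⇒> 4≰h) in ⊥-elim (<⇒≱ (s≤s (s≤s (+-mono-≤ h≤3 h≤3))) 8≤x)
  2h+1≤4h : suc (h + h) ≤ 4 * h
  2h+1≤4h = ≤-trans (+-monoˡ-≤ (h + h) (≤-trans (s≤s z≤n) 4≤h)) (≤-of-+ (h + (h + h)) h (regroup h))
    where
    regroup : ∀ h → 4 * h ≡ h + (h + h) + h
    regroup = solve-∀
  odd : 2 * (suc (h + h) * 2 ^ h) ≤ 2 ^ suc (h + h)
  odd = ≤-cast (*-monoʳ-≤ 2 (*-monoˡ-≤ (2 ^ h) (≤-trans 2h+1≤4h (4h≤2^h h 4≤h))))
               refl (cong (2 *_) (sym (^-distribˡ-+-* 2 h h)))

-- b = ⌊log₂ m⌋, and a is the largest exponent with m^(2^a) < 2^m.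
module LargeCase {m d b a : ℕ} (256≤m : 256 ≤ m) (logBound : LogBound m d)
                 (2^b≤m : 2 ^ b ≤ m) (m<2^[1+b] : m < 2 ^ suc b)
                 (m^2^a<2^m : m ^ 2 ^ a < 2 ^ m) (2^m≤m^2^[1+a] : 2 ^ m ≤ m ^ 2 ^ suc a) where

  private
    1≤m : 1 ≤ m
    1≤m = ≤-trans (s≤s z≤n) 256≤m
    2≤m : 2 ≤ m
    2≤m = ≤-trans (s≤s (s≤s z≤n)) 256≤m
    instance
      m≢0 : NonZero m
      m≢0 = >-nonZero 1≤m

  8≤b : 8 ≤ b
  8≤b with 8 ≤? b
  ... | yes 8≤b = 8≤b
  ... | no  8≰b = ⊥-elim (<⇒≱ (≤-trans m<2^[1+b] (^-monoʳ-≤ 2 (s≤s (≤-pred (≰⇒> 8≰b))))) 256≤m)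

  ad≤2m : a * d ≤ 2 * m
  ad≤2m = 2^-cancel-≤ (≤-cast (ratio-bound {m} {d} logBound 1≤m 1 (2 ^ a) (1≤^ 2 a (s≤s z≤n)) m^2^a<2^m·1)
                              (sym (^-*-assoc 2 a d)) (trans (cong (_* 2 ^ (2 * m)) (^-zeroˡ d)) (*-identityˡ _)))
    where
    m^2^a<2^m·1 : m ^ 2 ^ a < 2 ^ (m * 1)
    m^2^a<2^m·1 = subst (λ x → m ^ 2 ^ a < 2 ^ x) (sym (*-identityʳ m)) m^2^a<2^m

  m<[1+b]2^[1+a] : m < suc b * 2 ^ suc a
  m<[1+b]2^[1+a] = 2^-cancel-< (≤-trans (s≤s 2^m≤m^2^[1+a]) (≤-cast m^2^[1+a]<⋯ refl (^-*-assoc 2 (suc b) (2 ^ suc a))))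
    where
    m^2^[1+a]<⋯ : m ^ 2 ^ suc a < (2 ^ suc b) ^ 2 ^ suc a
    m^2^[1+a]<⋯ = ^-monoˡ-< (2 ^ suc a) {{m^n≢0 2 (suc a)}} m<2^[1+b]

  a≤b : a ≤ b
  a≤b with a ≤? b
  ... | yes a≤b = a≤b
  ... | no  a≰b = ⊥-elim (<⇒≱ m^2^a<2^m (begin
    2 ^ m             ≤⟨ ^-monoʳ-≤ 2 (<⇒≤ m<2^[1+b]) ⟩
    2 ^ 2 ^ suc b     ≤⟨ ^-monoʳ-≤ 2 (^-monoʳ-≤ 2 (≰⇒> a≰b)) ⟩
    2 ^ 2 ^ a         ≤⟨ ^-monoˡ-≤ (2 ^ a) 2≤m ⟩
    m ^ 2 ^ a         ∎))
    where open ≤-Reasoning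

  private
    half : ∃[ h ] (4 ≤ h × suc b ≤ suc (h + h) × 2 * (suc b * 2 ^ h) ≤ 2 ^ suc b)
    half = halving (suc b) (≤-trans 8≤b (n≤1+n b))
    h : ℕ
    h = proj₁ half
    4≤h : 4 ≤ h
    4≤h = proj₁ (proj₂ half)
    1+b≤2h+1 : suc b ≤ suc (h + h)
    1+b≤2h+1 = proj₁ (proj₂ (proj₂ half))

  [1+b]2^h≤m : suc b * 2 ^ h ≤ m
  [1+b]2^h≤m = *-cancelˡ-≤ 2 (≤-trans (proj₂ (proj₂ (proj₂ half))) (*-monoʳ-≤ 2 2^b≤m))

  h≤a : h ≤ a
  h≤a with h ≤? a
  ... | yes h≤a = h≤a
  ... | no  h≰a = ⊥-elim (<⇒≱ (≤-trans (s≤s (^-monoʳ-≤ m (^-monoʳ-≤ 2 (≰⇒> h≰a)))) m^2^h<2^m) 2^m≤m^2^[1+a])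
    where
    m^2^h<2^m : m ^ 2 ^ h < 2 ^ m
    m^2^h<2^m = ≤-trans (^-monoˡ-< (2 ^ h) {{m^n≢0 2 h}} m<2^[1+b])
                        (≤-cast (^-monoʳ-≤ 2 [1+b]2^h≤m) (^-*-assoc 2 (suc b) (2 ^ h)) refl)

  4≤a : 4 ≤ a
  4≤a = ≤-trans 4≤h h≤a

  2[1+b]≤a[1+a] : 2 * suc b ≤ a * suc a
  2[1+b]≤a[1+a] = begin
    2 * suc b             ≤⟨ *-monoʳ-≤ 2 1+b≤2h+1 ⟩
    2 * suc (h + h)       ≤⟨ ≤-of-+ (2 * suc (h + h)) 2 (regroup h) ⟩
    4 * suc h             ≤⟨ *-monoˡ-≤ (suc h) 4≤h ⟩
    h * suc h             ≤⟨ *-mono-≤ h≤a (s≤s h≤a) ⟩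
    a * suc a             ∎
    where
    open ≤-Reasoning
    regroup : ∀ h → 4 * suc h ≡ 2 * suc (h + h) + 2
    regroup = solve-∀

  [1+b][2a+7]<m : suc b * (2 * a + 7) < m
  [1+b][2a+7]<m = ≤-trans (s≤s (*-monoʳ-≤ (suc b) (+-monoˡ-≤ 7 (*-monoʳ-≤ 2 a≤b)))) (≤-trans ([b+1][2b+7]<2^b b 8≤b) 2^b≤m)

  2[1+b]≤m : 2 * suc b ≤ m
  2[1+b]≤m = ≤-trans (≤-cast (*-monoʳ-≤ (suc b) (≤-trans (s≤s (s≤s z≤n)) (m≤n+m 7 (2 * a)))) (*-comm 2 (suc b)) refl)
                     (<⇒≤ [1+b][2a+7]<m)

  infeasible-≤a : ∀ j → 1 ≤ j → j ≤ a → ¬ Feasible m d j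
  infeasible-≤a 1 _ _ feasible = <⇒≱ (*-monoʳ-≤ 3 1≤m) 3m≤2
    where
    2m≤1+d : 2 * m ≤ 1 + d
    2m≤1+d = +-cancelʳ-≤ 8 (2 * m) (1 + d) (≤-cast feasible refl (regroup d))
      where
      regroup : ∀ d → 2 * 1 * 1 + 5 * 1 + 2 + 1 * d ≡ 1 + d + 8
      regroup = solve-∀
    2d≤m : 2 * d ≤ m
    2d≤m = *-cancelˡ-≤ 2 (≤-cast (≤-trans (*-monoˡ-≤ d 4≤a) ad≤2m) (regroup d) refl)
      where
      regroup : ∀ d → 2 * (2 * d) ≡ 4 * d
      regroup = solve-∀
    3m≤2 : 3 * m ≤ 2
    3m≤2 = +-cancelʳ-≤ m (3 * m) 2 (begin
      3 * m + m    ≡⟨ regroup m ⟩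
      2 * (2 * m)  ≤⟨ *-monoʳ-≤ 2 2m≤1+d ⟩
      2 * (1 + d)  ≡⟨ regroup′ d ⟩
      2 + 2 * d    ≤⟨ +-monoʳ-≤ 2 2d≤m ⟩
      2 + m        ∎)
      where
      open ≤-Reasoning
      regroup : ∀ m → 3 * m + m ≡ 2 * (2 * m)
      regroup = solve-∀
      regroup′ : ∀ d → 2 * (1 + d) ≡ 2 + 2 * d
      regroup′ = solve-∀
  infeasible-≤a (suc (suc i)) _ j≤a feasible = <-irrefl refl (≤-trans chain jP≤Q)
    where
    j Q : ℕ
    j = suc (suc i)
    Q = 2 * j * j + 5 * j + 2
    jP≤Q : j * 2 ^ (2 + j) ≤ Q
    jP≤Q = +-cancelʳ-≤ (2 * m) _ _
             (≤-cast (≤-trans feasible (+-monoʳ-≤ Q (≤-trans (*-monoˡ-≤ d j≤a) ad≤2m))) (+-comm _ (2 * m)) refl)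
    chain : suc Q ≤ j * 2 ^ (2 + j)
    chain = ≤-trans (≤-cast (+-monoʳ-≤ Q (s≤s (z≤n {3 * i + 3}))) (+-comm 1 Q) (regroup i)) (*-monoʳ-≤ j (2j+12≤2^[j+4] i))
      where
      regroup : ∀ i → 2 * (2 + i) * (2 + i) + 5 * (2 + i) + 2 + suc (3 * i + 3) ≡ (2 + i) * (2 * i + 12)
      regroup = solve-∀

  -- Feasible times a, with a d ≤ 2m and m < (b + 1) 2^(a+1), gives upper; lower shows that J > a makes it fail.
  infeasible-a+e : ∀ e → 1 ≤ e → ¬ Feasible m d (a + e)
  infeasible-a+e e 1≤e feasible = <-irrefl refl (≤-trans lower upper)
    where
    J P Q : ℕ
    J = a + e
    P = 2 ^ (2 + J)
    Q = 2 * J * J + 5 * J + 2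
    1≤a : 1 ≤ a
    1≤a = ≤-trans (s≤s z≤n) 4≤a
    1≤J : 1 ≤ J
    1≤J = ≤-trans 1≤a (m≤m+n a e)
    aJP≤aQ+2me : a * J * P ≤ a * Q + 2 * m * e
    aJP≤aQ+2me = +-cancelʳ-≤ (2 * m * a) _ _
      (≤-cast (≤-trans (*-monoʳ-≤ a feasible) (≤-cast (+-monoʳ-≤ (a * Q) (*-monoʳ-≤ J ad≤2m)) (expand a Q J d) refl))
              (collect a J P m) (collect′ a Q m e))
      where
      expand : ∀ a Q J d → a * (Q + J * d) ≡ a * Q + J * (a * d)
      expand = solve-∀
      collect : ∀ a J P m → a * J * P + 2 * m * a ≡ a * (2 * m + J * P)
      collect = solve-∀
      collect′ : ∀ a Q m e → a * Q + (a + e) * (2 * m) ≡ a * Q + 2 * m * e + 2 * m * a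
      collect′ = solve-∀
    P≡ : P ≡ 2 ^ suc a * 2 ^ suc e
    P≡ = trans (cong (2 ^_) (split a e)) (^-distribˡ-+-* 2 (suc a) (suc e))
      where
      split : ∀ a e → 2 + (a + e) ≡ suc a + suc e
      split = solve-∀
    upper : a * J * suc m * 2 ^ suc e ≤ suc b * (a * Q + 2 * m * e)
    upper = ≤-trans (*-monoˡ-≤ (2 ^ suc e) (*-monoʳ-≤ (a * J) m<[1+b]2^[1+a]))
      (≤-cast (*-monoʳ-≤ (suc b) aJP≤aQ+2me)
              (sym (trans (cong (λ x → suc b * (a * J * x)) P≡) (regroup a J (suc b) (2 ^ suc a) (2 ^ suc e)))) refl)
      where
      regroup : ∀ a J b x y → b * (a * J * (x * y)) ≡ a * J * (b * x) * y
      regroup = solve-∀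
    2[1+b]me≤aJm2^e : 2 * suc b * m * e ≤ a * J * m * 2 ^ e
    2[1+b]me≤aJm2^e = ≤-cast (*-monoˡ-≤ m (*-mono-≤ (≤-trans 2[1+b]≤a[1+a] (*-monoʳ-≤ a (≤-cast (+-monoʳ-≤ a 1≤e) (+-comm 1 a) refl)))
                                                   (≤-trans (n≤1+n e) (suc≤2^ e))))
                             (regroup (suc b) m e) (regroup′ a J (2 ^ e) m)
      where
      regroup : ∀ b m e → 2 * b * m * e ≡ 2 * b * e * m
      regroup = solve-∀
      regroup′ : ∀ a J x m → a * J * x * m ≡ a * J * m * x
      regroup′ = solve-∀
    Q≤J[2J+7] : Q ≤ J * (2 * J + 7)
    Q≤J[2J+7] = +-cancelʳ-≤ 2 _ _ (≤-cast (+-monoʳ-≤ Q (*-monoʳ-≤ 2 1≤J)) refl (regroup J))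
      where
      regroup : ∀ J → (2 * J * J + 5 * J + 2) + 2 * J ≡ J * (2 * J + 7) + 2
      regroup = solve-∀
    [1+b][2J+7]<m2^e : suc (suc b * (2 * J + 7)) ≤ m * 2 ^ e
    [1+b][2J+7]<m2^e = ≤-trans (≤-cast (+-mono-≤ [1+b][2a+7]<m (*-monoˡ-≤ e 2[1+b]≤m)) (split (suc b) a e) (collect m e))
                               (*-monoʳ-≤ m (suc≤2^ e))
      where
      split : ∀ b a e → suc (b * (2 * (a + e) + 7)) ≡ suc (b * (2 * a + 7)) + 2 * b * e
      split = solve-∀
      collect : ∀ m e → m + m * e ≡ m * suc e
      collect = solve-∀
    [1+b]Q<Jm2^e : suc (suc b * Q) ≤ J * (m * 2 ^ e)
    [1+b]Q<Jm2^e = ≤-trans (s≤s (≤-cast (*-monoʳ-≤ (suc b) Q≤J[2J+7]) refl (regroup (suc b) J)))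
                           (*-monoʳ-<′ J 1≤J [1+b][2J+7]<m2^e)
      where
      regroup : ∀ b J → b * (J * (2 * J + 7)) ≡ J * (b * (2 * J + 7))
      regroup = solve-∀
    lower : suc (suc b * (a * Q + 2 * m * e)) ≤ a * J * suc m * 2 ^ suc e
    lower = ≤-trans (≤-cast (+-mono-≤ (*-monoʳ-<′ a 1≤a [1+b]Q<Jm2^e) 2[1+b]me≤aJm2^e)
                            (split (suc b) a Q m e) (collect a J m (2 ^ e)))
                    (*-monoˡ-≤ (2 ^ suc e) (*-monoʳ-≤ (a * J) (n≤1+n m)))
      where
      split : ∀ b a Q m e → suc (b * (a * Q + 2 * m * e)) ≡ suc (a * (b * Q)) + 2 * b * m * e
      split = solve-∀
      collect : ∀ a J m x → a * (J * (m * x)) + a * J * m * x ≡ a * J * m * (2 * x)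
      collect = solve-∀

  infeasible : ∀ j → 1 ≤ j → ¬ Feasible m d j
  infeasible j 1≤j with j ≤? a
  ... | yes j≤a = infeasible-≤a j 1≤j j≤a
  ... | no  j≰a = subst (¬_ ∘ Feasible m d) (m+[n∸m]≡n (<⇒≤ (≰⇒> j≰a))) (infeasible-a+e (j ∸ a) (m<n⇒0<n∸m (≰⇒> j≰a)))

threshold : (P : ℕ → Set) → (∀ x → Dec (P x)) → ¬ P 0 → ∀ N → P N → ∃[ a ] (¬ P a × P (suc a))
threshold P P? ¬P0 zero    PN = ⊥-elim (¬P0 PN)
threshold P P? ¬P0 (suc N) PN with P? N
... | yes PN′ = threshold P P? ¬P0 N PN′
... | no  ¬PN = N , ¬PN , PN

infeasible-large : ∀ {m d} → 256 ≤ m → LogBound m d → ∀ j → 1 ≤ j → ¬ Feasible m d j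
infeasible-large {m} {d} 256≤m logBound
  with threshold (λ b → m < 2 ^ b) (λ b → m <? 2 ^ b) (λ m<1 → <⇒≱ m<1 (≤-trans (s≤s z≤n) 256≤m)) m (suc≤2^ m)
... | b , m≮2^b , m<2^[1+b]
  with threshold (λ a → 2 ^ m ≤ m ^ 2 ^ a) (λ a → 2 ^ m ≤? m ^ 2 ^ a)
                 (<⇒≱ (subst (_< 2 ^ m) (sym (*-identityʳ m)) (suc≤2^ m))) m
                 (≤-trans (^-monoʳ-≤ 2 (<⇒≤ (suc≤2^ m))) (^-monoˡ-≤ (2 ^ m) (≤-trans (s≤s (s≤s z≤n)) 256≤m)))
... | a , 2^m≰m^2^a , 2^m≤m^2^[1+a] =
  LargeCase.infeasible {m} {d} {b} {a} 256≤m logBound (≮⇒≥ m≮2^b) m<2^[1+b] (≰⇒> 2^m≰m^2^a) 2^m≤m^2^[1+a]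

infeasible : ∀ {m d} → 3 ≤ m → LogBound m d → ∀ j → 1 ≤ j → j + 2 ≤ m → ¬ (j ≡ 1 × m ≤ 5) → ¬ Feasible m d j
infeasible {m} 3≤m logBound j 1≤j j+2≤m ¬small with 256 ≤? m
... | yes 256≤m = infeasible-large 256≤m logBound j 1≤j
... | no  256≰m = infeasible-small 3≤m (≤-pred (≰⇒> 256≰m)) logBound j 1≤j j+2≤m ¬small

excess-feasible : ∀ {n m} j → CountingBounds n m (3 + j) → 2 * m < n × Feasible m (n ∸ 2 * m) (suc j)
excess-feasible {n} j bounds = subst (λ m → 2 * m < n × Feasible m (n ∸ 2 * m) (suc j)) w+k≡m
  (2m<n , key⇒feasible (suc j) w _ (subst (λ n → _ ≤ suc j * n + suc j) (sym (m+[n∸m]≡n (<⇒≤ 2m<n))) key))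
  where
  open CountingBounds bounds
  key : 2 * suc (suc j) * suc w + suc j * 2 ^ (3 + j) ≤ suc j * n + suc j
  key = key-inequality (suc j) n w S G S-upper S-lower G-eq
  2m<n : 2 * (w + (3 + j)) < n
  2m<n = key⇒2m<n (suc j) n w (s≤s z≤n) key

3+j≤m : ∀ {n m} j → CountingBounds n m (3 + j) → 3 + j ≤ m
3+j≤m j bounds = ≤-of-+ (3 + j) (CountingBounds.w bounds) (trans (sym (CountingBounds.w+k≡m bounds)) (+-comm _ (3 + j)))

large-transversal : ∀ {n m} j → CountingBounds n m (3 + j) → SizeBound n m → ⊥
large-transversal j bounds (inj₁ n≤2m) = <⇒≱ (proj₁ (excess-feasible j bounds)) n≤2m
large-transversal {n} {m} (suc j) bounds (inj₂ logBound) =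
  infeasible {m} {n ∸ 2 * m} (≤-trans (s≤s (s≤s (s≤s z≤n))) (3+j≤m (suc j) bounds)) logBound (2 + j) (s≤s z≤n)
             (subst (_≤ m) (+-comm 2 (2 + j)) (3+j≤m (suc j) bounds)) (λ ()) (proj₂ (excess-feasible (suc j) bounds))
large-transversal {n} {m} zero bounds (inj₂ logBound) with m ≤? 5
... | yes m≤5 = three-element-transversal bounds m≤5 (excess-feasible 0 bounds)
... | no  m≰5 = infeasible {m} {n ∸ 2 * m} (3+j≤m 0 bounds) logBound 1 ≤-refl (3+j≤m 0 bounds) (m≰5 ∘ proj₂)
                           (proj₂ (excess-feasible 0 bounds))

bounds-contradict : ∀ {n m k} → 3 ≤ n → CountingBounds n m k → SizeBound n m → ⊥
bounds-contradict {n} {m} {k} 3≤n bounds =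
  large-transversal (k ∸ 3) (subst (CountingBounds n m) (sym (m+[n∸m]≡n (3≤k 3≤n bounds))) bounds)

mainTheorem2 : ∀ (k : ℕ) (𝒜 : Family k) →
    NonEmptyFamily 𝒜 → UnionClosed 𝒜 → Separating 𝒜 →
    2 ≤ ∣ universe 𝒜 ∣ →
    SizeBound (size 𝒜) ∣ universe 𝒜 ∣ →
    ∃[ x ] (x ∈ universe 𝒜 × size 𝒜 ≤ 2 * frequency 𝒜 x)
mainTheorem2 k 𝒜 ne uc sep 2≤m sizeBound with any? (λ x → x ∈? universe 𝒜 ×-dec size 𝒜 ≤? 2 * frequency 𝒜 x)
... | yes frequent = frequent
... | no  ¬frequent = ⊥-elim (bounds-contradict (3≤size U≢∅) countingBounds sizeBound)
  where
  rare : ∀ {x} → x ∈ universe 𝒜 → 2 * frequency 𝒜 x < size 𝒜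
  rare x∈U = ≰⇒> (λ n≤2f → ¬frequent (_ , x∈U , n≤2f))
  open Counting 𝒜 uc sep ne rare
  U≢∅ : Nonempty (universe 𝒜)
  U≢∅ with nonempty? (universe 𝒜)
  ... | yes ne = ne
  ... | no  empty = ⊥-elim (<⇒≱ 2≤m (≤-trans (≤-reflexive (trans (cong ∣_∣ (Empty-unique empty)) (∣⊥∣≡0 k))) z≤n))
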